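{- Let $q=p^n\ge3$ with $p$ prime, let $r\in\mathbb{F}_q^*$ and $b=r^{p-1}$ (an $\frac{p^n-1}{p-1}$-th root of unity). Let $V[x]$ be the $\mathbb{F}_q$-vector space of polynomials $f\in\mathbb{F}_q[x]$ of degree at most $q-2$ with $f(0)=0$, and let $A_r:V[x]\to V[x]$ be the linear map $A_r(f)(x)=f(x+r)-f(r)$. Then the eigenspace $\ker(A_r-I)$ is spanned by the monomials $x,x^p,x^{p^2},\ldots,x^{p^{n-1}}$ and the polynomials $(x^p-bx)^i$ for $i=2,\ldots,p^{n-1}-1$ with $i$ not a power of $p$.
   Context: Polynomials in $V[x]$ are formal polynomials; $f(x+r)$ denotes formal substitution; $I$ is the identity map of $V[x]$. -}

module Defs where

open import Level using (Level; _⊔_) renaming (suc to lsuc)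
open import Algebra.Bundles using (CommutativeRing)
open import Relation.Nullary using (¬_)
open import Data.Product using (Σ; ∃; _×_; _,_; proj₂)
open import Data.Sum using (_⊎_)
open import Data.Nat as ℕ using (ℕ; zero; suc; _<_; _≤_; _∸_)
open import Data.List using (List; []; _∷_; map)
open import Data.List.Relation.Unary.All using (All)
open import Relation.Binary.PropositionalEquality using (_≡_)

record Field c ℓ : Set (lsuc (c ⊔ ℓ)) where
  field
    commutativeRing : CommutativeRing c ℓ
  open CommutativeRing commutativeRing public
  field
    1≉0     : ¬ (1# ≈ 0#)
    inverse : ∀ x → ¬ (x ≈ 0#) → ∃ λ y → (x * y) ≈ 1#

-- Formal polynomials over a field, as coefficient lists (constant term first).
module PolyOps {c ℓ} (F : Field c ℓ) where
  open Field F

  Poly : Set c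
  Poly = List Carrier

  coeff : Poly → ℕ → Carrier
  coeff []      _       = 0#
  coeff (a ∷ f) zero    = a
  coeff (a ∷ f) (suc i) = coeff f i

  _≈ₚ_ : Poly → Poly → Set ℓ
  f ≈ₚ g = ∀ i → coeff f i ≈ coeff g i

  _+ₚ_ : Poly → Poly → Poly
  []      +ₚ g       = g
  (a ∷ f) +ₚ []      = a ∷ f
  (a ∷ f) +ₚ (b ∷ g) = (a + b) ∷ (f +ₚ g)

  _·ₚ_ : Carrier → Poly → Poly
  k ·ₚ f = map (k *_) f

  -ₚ_ : Poly → Poly
  -ₚ f = map -_ f

  _*ₚ_ : Poly → Poly → Poly
  []      *ₚ g = []
  (a ∷ f) *ₚ g = (a ·ₚ g) +ₚ (0# ∷ (f *ₚ g))

  constP : Carrier → Poly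
  constP a = a ∷ []

  X : Poly
  X = 0# ∷ 1# ∷ []

  _^ₚ_ : Poly → ℕ → Poly
  f ^ₚ zero  = constP 1#
  f ^ₚ suc k = f *ₚ (f ^ₚ k)

  _^F_ : Carrier → ℕ → Carrier
  a ^F zero  = 1#
  a ^F suc k = a * (a ^F k)

  eval : Poly → Carrier → Carrier
  eval []      r = 0#
  eval (a ∷ f) r = a + r * eval f r

  -- formal substitution f(x + r)  (Horner scheme)
  shift : Carrier → Poly → Poly
  shift r []      = []
  shift r (a ∷ f) = constP a +ₚ ((X +ₚ constP r) *ₚ shift r f)

  A : Carrier → Poly → Poly
  A r f = shift r f +ₚ (-ₚ constP (eval f r))

  -- V[x] for q: degree ≤ q - 2 and f(0) = 0 (zero constant term)
  InV : ℕ → Poly → Set ℓ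
  InV q f = (∀ i → q ∸ 1 ≤ i → coeff f i ≈ 0#) × (coeff f 0 ≈ 0#)

  linComb : List (Carrier × Poly) → Poly
  linComb []            = []
  linComb ((k , g) ∷ L) = (k ·ₚ g) +ₚ linComb L

  InSpan : ∀ {g} → (Poly → Set g) → Poly → Set (c ⊔ ℓ ⊔ g)
  InSpan G f = ∃ λ (L : List (Carrier × Poly)) → All (λ t → G (proj₂ t)) L × (f ≈ₚ linComb L)

  Gen : ℕ → ℕ → Carrier → Poly → Set c
  Gen p n b g =
      (∃ λ k → (k < n) × (g ≡ X ^ₚ (p ℕ.^ k)))
    ⊎ (∃ λ i → (2 ≤ i) × (i ≤ p ℕ.^ (n ∸ 1) ∸ 1) × (¬ (∃ λ k → p ℕ.^ k ≡ i))
               × (g ≡ ((X ^ₚ p) +ₚ (-ₚ (b ·ₚ X))) ^ₚ i))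

{-# OPTIONS --safe #-}
module Submission where

-- Let σ be the substitution f(x) ↦ f(x + r). A field with q = p^n elements has characteristic p,
-- so σ is a ring endomorphism fixing g = x^p - b x (as r^p = b r) and sending x^(p^k) to
-- x^(p^k) + r^(p^k). The equation A_r f = f says σ f = f + f(r), i.e. h = f - (f(r) / r) x is
-- σ-fixed. Dividing by g shows that σ-fixed polynomials of degree < p^n are polynomials of
-- degree < p^(n-1) in g: the remainder has degree < p, and comparing coefficients (k · 1 ≠ 0 for
-- 0 < k < p) forces a σ-fixed remainder to be constant. As f(0) = 0, h has no constant term,
-- and by Frobenius g^(p^k) = x^(p^(k+1)) + (-b)^(p^k) x^(p^k), so the powers of g whose
-- exponent is a power of p are traded for monomials. Conversely every listed generator is
-- fixed by A_r, since σ fixes g and shifts x^(p^k) by a constant.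

open import Defs
open import Level using (Level; _⊔_)
open import Algebra.Bundles using (CommutativeRing)
import Algebra.Properties.CommutativeMonoid.Sum
import Algebra.Properties.CommutativeSemiring.Binomial
import Algebra.Properties.CommutativeSemiring.Exp
import Algebra.Properties.Semiring.Exp
import Algebra.Properties.Semiring.Mult
import Algebra.Properties.Semiring.Sum
open import Algebra.Solver.Ring.AlmostCommutativeRing as ACR using (_-Raw-AlmostCommutative⟶_)
open import Data.Empty using (⊥-elim)
open import Data.Fin as Fin using (Fin)
import Data.Fin.Properties as Fin
open import Data.Fin.Permutation using (permutation)
open import Data.Integer as ℤ using (ℤ; +_; -[1+_])
import Data.Integer.Properties as ℤP
open import Data.List using (List; []; _∷_; length; _++_)
open import Data.List.Relation.Unary.All using (All; []; _∷_)
import Data.List.Relation.Unary.All.Properties as All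
open import Data.Maybe using (Maybe; just; nothing)
open import Data.Nat as ℕ using (ℕ; zero; suc; s≤s; z≤n; _≤_; _^_; _∸_; nonTrivial⇒n>1)
import Data.Nat.Properties as ℕP
open import Data.Nat.Coprimality using (prime⇒coprime; coprime-Bézout)
open import Data.Nat.Combinatorics using (_C_; k![n∸k]!∣n!; nCn≡1)
open import Data.Nat.Combinatorics.Specification using (nCk≡n!/k![n-k]!)
open import Data.Nat.GCD using (module Bézout)
open import Data.Nat.Divisibility using (_∣_; divides; m∣m*n; ∣⇒≤; >⇒∤)
open import Data.Nat.DivMod using (m*[n/m]≡n)
open import Data.Nat.Primality using (Prime; euclidsLemma; prime⇒nonTrivial)
open import Data.Nat.Properties using (_!*_!≢0)
open import Data.Product using (Σ; ∃; _×_; _,_; proj₁; proj₂)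
import Data.Sign as Sign
open import Data.Sum using (inj₁; inj₂)
open import Data.Vec using (Vec; []; _∷_)
open import Function.Bundles using (Inverse; _⇔_; mk⇔)
open import Relation.Nullary using (¬_; Dec; yes; no)
open import Relation.Binary.PropositionalEquality as ≡ using (_≡_; _≢_)
open import Relation.Binary.PropositionalEquality.Properties using (setoid)

module IntegerCoefficients {c ℓ} (R : CommutativeRing c ℓ) where
  open CommutativeRing R hiding (setoid)
  open import Algebra.Properties.Ring ring
    using (-‿distribˡ-*; -‿distribʳ-*; -‿involutive; -0#≈0#; -‿anti-homo-+)
  open import Algebra.Properties.Semiring.Mult semiring
    using (×-homo-+; ×1-homo-*) renaming (_×_ to _⨰_)
  open import Relation.Binary.Reasoning.Setoid (CommutativeRing.setoid R)

  ⟦_⟧ℤ : ℤ → Carrier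
  ⟦ + n ⟧ℤ      = n ⨰ 1#
  ⟦ -[1+ n ] ⟧ℤ = - (suc n ⨰ 1#)

  private
    1+-cancel : ∀ a b → (1# + a) - (1# + b) ≈ a - b
    1+-cancel a b = begin
      (1# + a) + - (1# + b)   ≈⟨ +-congˡ (-‿anti-homo-+ 1# b) ⟩
      (1# + a) + (- b + - 1#) ≈⟨ +-cong (+-comm 1# a) (+-comm (- b) (- 1#)) ⟩
      (a + 1#) + (- 1# + - b) ≈⟨ +-assoc a 1# _ ⟩
      a + (1# + (- 1# + - b)) ≈⟨ +-congˡ (sym (+-assoc 1# (- 1#) (- b))) ⟩
      a + ((1# + - 1#) + - b) ≈⟨ +-congˡ (+-congʳ (-‿inverseʳ 1#)) ⟩
      a + (0# + - b)          ≈⟨ +-congˡ (+-identityˡ _) ⟩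
      a + - b                 ∎

  ⊖-homo : ∀ m n → ⟦ m ℤ.⊖ n ⟧ℤ ≈ m ⨰ 1# - n ⨰ 1#
  ⊖-homo zero    zero    = sym (trans (+-congˡ -0#≈0#) (+-identityʳ _))
  ⊖-homo (suc m) zero    = sym (trans (+-congˡ -0#≈0#) (+-identityʳ _))
  ⊖-homo zero    (suc n) = sym (+-identityˡ _)
  ⊖-homo (suc m) (suc n) = begin
    ⟦ suc m ℤ.⊖ suc n ⟧ℤ      ≈⟨ reflexive (≡.cong ⟦_⟧ℤ (ℤP.[1+m]⊖[1+n]≡m⊖n m n)) ⟩
    ⟦ m ℤ.⊖ n ⟧ℤ              ≈⟨ ⊖-homo m n ⟩
    m ⨰ 1# - n ⨰ 1#           ≈⟨ sym (1+-cancel _ _) ⟩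
    suc m ⨰ 1# - suc n ⨰ 1#   ∎

  ◃-homo⁺ : ∀ k → ⟦ Sign.+ ℤ.◃ k ⟧ℤ ≈ k ⨰ 1#
  ◃-homo⁺ zero    = refl
  ◃-homo⁺ (suc k) = refl

  ◃-homo⁻ : ∀ k → ⟦ Sign.- ℤ.◃ k ⟧ℤ ≈ - (k ⨰ 1#)
  ◃-homo⁻ zero    = sym -0#≈0#
  ◃-homo⁻ (suc k) = refl

  +-homo : ∀ i j → ⟦ i ℤ.+ j ⟧ℤ ≈ ⟦ i ⟧ℤ + ⟦ j ⟧ℤ
  +-homo (+ m)    (+ n)    = ×-homo-+ 1# m n
  +-homo (+ m)    -[1+ n ] = ⊖-homo m (suc n)
  +-homo -[1+ m ] (+ n)    = trans (⊖-homo n (suc m)) (+-comm _ _)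
  +-homo -[1+ m ] -[1+ n ] = begin
    - (suc (suc (m ℕ.+ n)) ⨰ 1#)     ≡⟨ ≡.cong (λ k → - (suc k ⨰ 1#)) (≡.sym (ℕP.+-suc m n)) ⟩
    - ((suc m ℕ.+ suc n) ⨰ 1#)       ≈⟨ -‿cong (×-homo-+ 1# (suc m) (suc n)) ⟩
    - (suc m ⨰ 1# + suc n ⨰ 1#)      ≈⟨ -‿anti-homo-+ _ _ ⟩
    - (suc n ⨰ 1#) + - (suc m ⨰ 1#)  ≈⟨ +-comm _ _ ⟩
    - (suc m ⨰ 1#) + - (suc n ⨰ 1#)  ∎

  *-homo : ∀ i j → ⟦ i ℤ.* j ⟧ℤ ≈ ⟦ i ⟧ℤ * ⟦ j ⟧ℤ
  *-homo (+ m) (+ n) = trans (◃-homo⁺ (m ℕ.* n)) (×1-homo-* m n)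
  *-homo (+ m) -[1+ n ] =
    trans (◃-homo⁻ (m ℕ.* suc n)) (trans (-‿cong (×1-homo-* m (suc n))) (-‿distribʳ-* _ _))
  *-homo -[1+ m ] (+ n) =
    trans (◃-homo⁻ (suc m ℕ.* n)) (trans (-‿cong (×1-homo-* (suc m) n)) (-‿distribˡ-* _ _))
  *-homo -[1+ m ] -[1+ n ] = begin
    ⟦ Sign.+ ℤ.◃ (suc m ℕ.* suc n) ⟧ℤ ≈⟨ ◃-homo⁺ (suc m ℕ.* suc n) ⟩
    (suc m ℕ.* suc n) ⨰ 1#            ≈⟨ ×1-homo-* (suc m) (suc n) ⟩
    a * b                             ≈⟨ sym (-‿involutive _) ⟩
    - (- (a * b))                     ≈⟨ -‿cong (-‿distribʳ-* a b) ⟩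
    - (a * - b)                       ≈⟨ -‿distribˡ-* a (- b) ⟩
    - a * - b                         ∎
    where a = suc m ⨰ 1#
          b = suc n ⨰ 1#

  -‿homo : ∀ i → ⟦ ℤ.- i ⟧ℤ ≈ - ⟦ i ⟧ℤ
  -‿homo (+ zero)  = sym -0#≈0#
  -‿homo (+ suc n) = refl
  -‿homo -[1+ n ]  = sym (-‿involutive _)

  ℤ-morphism : ℤ.+-*-rawRing -Raw-AlmostCommutative⟶ ACR.fromCommutativeRing R
  ℤ-morphism = record
    { ⟦_⟧ = ⟦_⟧ℤ ; +-homo = +-homo ; *-homo = *-homo ; -‿homo = -‿homo
    ; 0-homo = refl ; 1-homo = +-identityʳ 1# }

  ℤ-coefficients≟ : ∀ i j → Maybe (⟦ i ⟧ℤ ≈ ⟦ j ⟧ℤ)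
  ℤ-coefficients≟ i j with i ℤ.≟ j
  ... | yes ≡.refl = just refl
  ... | no _       = nothing

  open import Algebra.Solver.Ring ℤ.+-*-rawRing (ACR.fromCommutativeRing R) ℤ-morphism ℤ-coefficients≟
    public

module PolynomialRing {c ℓ} (F : Field c ℓ) where
  open Field F hiding (setoid)
  open PolyOps F
  open import Algebra.Properties.Ring ring using (-0#≈0#)
  open IntegerCoefficients commutativeRing using (solve; _:+_; _:*_; _:=_; con)
  open import Relation.Binary.Reasoning.Setoid (Field.setoid F)

  infix 4 _≋_
  record _≋_ (f g : Poly) : Set ℓ where
    constructor coeffwise
    field at : f ≈ₚ g
  open _≋_ public

  ≋-refl : ∀ {f} → f ≋ f
  ≋-refl = coeffwise λ _ → refl

  ≋-sym : ∀ {f g} → f ≋ g → g ≋ f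
  ≋-sym e = coeffwise λ i → sym (at e i)

  ≋-trans : ∀ {f g h} → f ≋ g → g ≋ h → f ≋ h
  ≋-trans e e′ = coeffwise λ i → trans (at e i) (at e′ i)

  ∷-cong : ∀ {a b f g} → a ≈ b → f ≋ g → (a ∷ f) ≋ (b ∷ g)
  ∷-cong a≈b e = coeffwise λ { zero → a≈b ; (suc i) → at e i }

  constP-cong : ∀ {a b} → a ≈ b → constP a ≋ constP b
  constP-cong a≈b = ∷-cong a≈b ≋-refl

  constP-0# : constP 0# ≋ []
  constP-0# = coeffwise λ { zero → refl ; (suc i) → refl }

  tailₚ : Poly → Poly
  tailₚ []      = []
  tailₚ (a ∷ f) = f

  coeff-tailₚ : ∀ f i → coeff (tailₚ f) i ≡ coeff f (suc i)
  coeff-tailₚ []      i = ≡.refl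
  coeff-tailₚ (a ∷ f) i = ≡.refl

  tailₚ-cong : ∀ {f g} → f ≋ g → tailₚ f ≋ tailₚ g
  tailₚ-cong {f} {g} e = coeffwise λ i →
    trans (reflexive (coeff-tailₚ f i)) (trans (at e (suc i)) (reflexive (≡.sym (coeff-tailₚ g i))))

  coeff-≥length : ∀ f i → length f ℕ.≤ i → coeff f i ≈ 0#
  coeff-≥length []      i       _         = refl
  coeff-≥length (a ∷ f) (suc i) (s≤s f≤i) = coeff-≥length f i f≤i

  coeff-+ : ∀ f g i → coeff (f +ₚ g) i ≈ coeff f i + coeff g i
  coeff-+ []      g       i       = sym (+-identityˡ _)
  coeff-+ (a ∷ f) []      i       = sym (+-identityʳ _)
  coeff-+ (a ∷ f) (b ∷ g) zero    = refl
  coeff-+ (a ∷ f) (b ∷ g) (suc i) = coeff-+ f g i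

  coeff-· : ∀ k f i → coeff (k ·ₚ f) i ≈ k * coeff f i
  coeff-· k []      i       = sym (zeroʳ k)
  coeff-· k (a ∷ f) zero    = refl
  coeff-· k (a ∷ f) (suc i) = coeff-· k f i

  coeff-neg : ∀ f i → coeff (-ₚ f) i ≈ - coeff f i
  coeff-neg []      i       = sym -0#≈0#
  coeff-neg (a ∷ f) zero    = refl
  coeff-neg (a ∷ f) (suc i) = coeff-neg f i

  coeff-*-zero : ∀ f g → coeff (f *ₚ g) 0 ≈ coeff f 0 * coeff g 0
  coeff-*-zero []      g = sym (zeroˡ _)
  coeff-*-zero (a ∷ f) g =
    trans (coeff-+ (a ·ₚ g) (0# ∷ (f *ₚ g)) 0) (trans (+-identityʳ _) (coeff-· a g 0))

  coeff-*-suc : ∀ f g i →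
    coeff (f *ₚ g) (suc i) ≈ coeff f 0 * coeff g (suc i) + coeff (tailₚ f *ₚ g) i
  coeff-*-suc []      g i = sym (trans (+-identityʳ _) (zeroˡ _))
  coeff-*-suc (a ∷ f) g i =
    trans (coeff-+ (a ·ₚ g) (0# ∷ (f *ₚ g)) (suc i)) (+-congʳ (coeff-· a g (suc i)))

  +ₚ-cong : ∀ {f f′ g g′} → f ≋ f′ → g ≋ g′ → (f +ₚ g) ≋ (f′ +ₚ g′)
  +ₚ-cong {f} {f′} {g} {g′} e e′ = coeffwise λ i →
    trans (coeff-+ f g i) (trans (+-cong (at e i) (at e′ i)) (sym (coeff-+ f′ g′ i)))

  +ₚ-congˡ : ∀ f {g g′} → g ≋ g′ → (f +ₚ g) ≋ (f +ₚ g′)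
  +ₚ-congˡ f = +ₚ-cong (≋-refl {f})

  +ₚ-congʳ : ∀ g {f f′} → f ≋ f′ → (f +ₚ g) ≋ (f′ +ₚ g)
  +ₚ-congʳ g e = +ₚ-cong e (≋-refl {g})

  ·ₚ-cong : ∀ {k k′ f f′} → k ≈ k′ → f ≋ f′ → (k ·ₚ f) ≋ (k′ ·ₚ f′)
  ·ₚ-cong {k} {k′} {f} {f′} k≈k′ e = coeffwise λ i →
    trans (coeff-· k f i) (trans (*-cong k≈k′ (at e i)) (sym (coeff-· k′ f′ i)))

  -ₚ-cong : ∀ {f f′} → f ≋ f′ → (-ₚ f) ≋ (-ₚ f′)
  -ₚ-cong {f} {f′} e = coeffwise λ i →
    trans (coeff-neg f i) (trans (-‿cong (at e i)) (sym (coeff-neg f′ i)))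

  +ₚ-assoc : ∀ f g h → ((f +ₚ g) +ₚ h) ≋ (f +ₚ (g +ₚ h))
  +ₚ-assoc f g h = coeffwise λ i → begin
    coeff ((f +ₚ g) +ₚ h) i             ≈⟨ trans (coeff-+ (f +ₚ g) h i) (+-congʳ (coeff-+ f g i)) ⟩
    (coeff f i + coeff g i) + coeff h i ≈⟨ +-assoc _ _ _ ⟩
    coeff f i + (coeff g i + coeff h i) ≈⟨ sym (trans (coeff-+ f (g +ₚ h) i) (+-congˡ (coeff-+ g h i))) ⟩
    coeff (f +ₚ (g +ₚ h)) i             ∎

  +ₚ-comm : ∀ f g → (f +ₚ g) ≋ (g +ₚ f)
  +ₚ-comm f g = coeffwise λ i → trans (coeff-+ f g i) (trans (+-comm _ _) (sym (coeff-+ g f i)))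

  +ₚ-identityʳ : ∀ f → (f +ₚ []) ≋ f
  +ₚ-identityʳ f = coeffwise λ i → trans (coeff-+ f [] i) (+-identityʳ _)

  +ₚ-inverseˡ : ∀ f → ((-ₚ f) +ₚ f) ≋ []
  +ₚ-inverseˡ f = coeffwise λ i →
    trans (coeff-+ (-ₚ f) f i) (trans (+-congʳ (coeff-neg f i)) (-‿inverseˡ _))

  +ₚ-inverseʳ : ∀ f → (f +ₚ (-ₚ f)) ≋ []
  +ₚ-inverseʳ f = coeffwise λ i →
    trans (coeff-+ f (-ₚ f) i) (trans (+-congˡ (coeff-neg f i)) (-‿inverseʳ _))

  *ₚ-congˡ : ∀ {f f′} g → f ≋ f′ → (f *ₚ g) ≋ (f′ *ₚ g)
  *ₚ-congˡ g e = coeffwise λ i → go i e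
    where
    go : ∀ i {f f′} → f ≋ f′ → coeff (f *ₚ g) i ≈ coeff (f′ *ₚ g) i
    go zero {f} {f′} e =
      trans (coeff-*-zero f g) (trans (*-congʳ (at e 0)) (sym (coeff-*-zero f′ g)))
    go (suc i) {f} {f′} e = trans (coeff-*-suc f g i)
      (trans (+-cong (*-congʳ (at e 0)) (go i (tailₚ-cong e))) (sym (coeff-*-suc f′ g i)))

  *ₚ-congʳ : ∀ f {g g′} → g ≋ g′ → (f *ₚ g) ≋ (f *ₚ g′)
  *ₚ-congʳ f {g} {g′} e = coeffwise λ i → go i f
    where
    go : ∀ i f → coeff (f *ₚ g) i ≈ coeff (f *ₚ g′) i
    go zero    f = trans (coeff-*-zero f g) (trans (*-congˡ (at e 0)) (sym (coeff-*-zero f g′)))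
    go (suc i) f = trans (coeff-*-suc f g i)
      (trans (+-cong (*-congˡ (at e (suc i))) (go i (tailₚ f))) (sym (coeff-*-suc f g′ i)))

  *ₚ-cong : ∀ {f f′ g g′} → f ≋ f′ → g ≋ g′ → (f *ₚ g) ≋ (f′ *ₚ g′)
  *ₚ-cong {f′ = f′} {g} e e′ = ≋-trans (*ₚ-congˡ g e) (*ₚ-congʳ f′ e′)

  *ₚ-zeroʳ : ∀ f → (f *ₚ []) ≋ []
  *ₚ-zeroʳ f = coeffwise λ i → go i f
    where
    go : ∀ i f → coeff (f *ₚ []) i ≈ 0#
    go zero    f = trans (coeff-*-zero f []) (zeroʳ _)
    go (suc i) f = trans (coeff-*-suc f [] i) (trans (+-cong (zeroʳ _) (go i (tailₚ f))) (+-identityʳ _))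

  tailₚ-+ : ∀ f g → tailₚ (f +ₚ g) ≋ (tailₚ f +ₚ tailₚ g)
  tailₚ-+ f g = coeffwise λ i → trans (reflexive (coeff-tailₚ (f +ₚ g) i))
    (trans (coeff-+ f g (suc i))
    (sym (trans (coeff-+ (tailₚ f) (tailₚ g) i)
      (+-cong (reflexive (coeff-tailₚ f i)) (reflexive (coeff-tailₚ g i))))))

  *ₚ-distribʳ : ∀ h f g → ((f +ₚ g) *ₚ h) ≋ ((f *ₚ h) +ₚ (g *ₚ h))
  *ₚ-distribʳ h f g = coeffwise λ i → go i f g
    where
    go : ∀ i f g → coeff ((f +ₚ g) *ₚ h) i ≈ coeff ((f *ₚ h) +ₚ (g *ₚ h)) i
    go zero f g = begin
      coeff ((f +ₚ g) *ₚ h) 0                       ≈⟨ trans (coeff-*-zero (f +ₚ g) h) (*-congʳ (coeff-+ f g 0)) ⟩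
      (coeff f 0 + coeff g 0) * coeff h 0           ≈⟨ distribʳ _ _ _ ⟩
      coeff f 0 * coeff h 0 + coeff g 0 * coeff h 0 ≈⟨ sym (trans (coeff-+ (f *ₚ h) (g *ₚ h) 0)
                                                          (+-cong (coeff-*-zero f h) (coeff-*-zero g h))) ⟩
      coeff ((f *ₚ h) +ₚ (g *ₚ h)) 0                ∎
    go (suc i) f g = begin
      coeff ((f +ₚ g) *ₚ h) (suc i)
        ≈⟨ coeff-*-suc (f +ₚ g) h i ⟩
      coeff (f +ₚ g) 0 * hᵢ + coeff (tailₚ (f +ₚ g) *ₚ h) i
        ≈⟨ +-cong (*-congʳ (coeff-+ f g 0)) (at (*ₚ-congˡ h (tailₚ-+ f g)) i) ⟩
      (f₀ + g₀) * hᵢ + coeff ((tailₚ f +ₚ tailₚ g) *ₚ h) i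
        ≈⟨ +-congˡ (trans (go i (tailₚ f) (tailₚ g)) (coeff-+ (tailₚ f *ₚ h) (tailₚ g *ₚ h) i)) ⟩
      (f₀ + g₀) * hᵢ + (coeff (tailₚ f *ₚ h) i + coeff (tailₚ g *ₚ h) i)
        ≈⟨ solve 5 (λ a b x u v → (a :+ b) :* x :+ (u :+ v) := (a :* x :+ u) :+ (b :* x :+ v))
                 refl f₀ g₀ hᵢ _ _ ⟩
      (f₀ * hᵢ + coeff (tailₚ f *ₚ h) i) + (g₀ * hᵢ + coeff (tailₚ g *ₚ h) i)
        ≈⟨ sym (trans (coeff-+ (f *ₚ h) (g *ₚ h) (suc i)) (+-cong (coeff-*-suc f h i) (coeff-*-suc g h i))) ⟩
      coeff ((f *ₚ h) +ₚ (g *ₚ h)) (suc i)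
        ∎
      where f₀ = coeff f 0
            g₀ = coeff g 0
            hᵢ = coeff h (suc i)

  tailₚ-· : ∀ k f → tailₚ (k ·ₚ f) ≡ k ·ₚ tailₚ f
  tailₚ-· k []      = ≡.refl
  tailₚ-· k (a ∷ f) = ≡.refl

  ·ₚ-*ₚ-assoc : ∀ k f g → ((k ·ₚ f) *ₚ g) ≋ (k ·ₚ (f *ₚ g))
  ·ₚ-*ₚ-assoc k f g = coeffwise λ i → go i f
    where
    go : ∀ i f → coeff ((k ·ₚ f) *ₚ g) i ≈ coeff (k ·ₚ (f *ₚ g)) i
    go zero f = begin
      coeff ((k ·ₚ f) *ₚ g) 0     ≈⟨ trans (coeff-*-zero (k ·ₚ f) g) (*-congʳ (coeff-· k f 0)) ⟩
      (k * coeff f 0) * coeff g 0 ≈⟨ *-assoc _ _ _ ⟩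
      k * (coeff f 0 * coeff g 0) ≈⟨ sym (trans (coeff-· k (f *ₚ g) 0) (*-congˡ (coeff-*-zero f g))) ⟩
      coeff (k ·ₚ (f *ₚ g)) 0     ∎
    go (suc i) f = begin
      coeff ((k ·ₚ f) *ₚ g) (suc i)
        ≈⟨ coeff-*-suc (k ·ₚ f) g i ⟩
      coeff (k ·ₚ f) 0 * gᵢ + coeff (tailₚ (k ·ₚ f) *ₚ g) i
        ≈⟨ +-cong (*-congʳ (coeff-· k f 0))
                  (trans (reflexive (≡.cong (λ u → coeff (u *ₚ g) i) (tailₚ-· k f)))
                  (trans (go i (tailₚ f)) (coeff-· k (tailₚ f *ₚ g) i))) ⟩
      (k * coeff f 0) * gᵢ + k * coeff (tailₚ f *ₚ g) i
        ≈⟨ solve 4 (λ k a x u → (k :* a) :* x :+ k :* u := k :* (a :* x :+ u)) refl k _ gᵢ _ ⟩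
      k * (coeff f 0 * gᵢ + coeff (tailₚ f *ₚ g) i)
        ≈⟨ sym (trans (coeff-· k (f *ₚ g) (suc i)) (*-congˡ (coeff-*-suc f g i))) ⟩
      coeff (k ·ₚ (f *ₚ g)) (suc i)
        ∎
      where gᵢ = coeff g (suc i)

  *ₚ-∷ : ∀ g a f → (g *ₚ (a ∷ f)) ≋ ((a ·ₚ g) +ₚ (0# ∷ (g *ₚ f)))
  *ₚ-∷ g a f = coeffwise λ i → go i g
    where
    go : ∀ i g → coeff (g *ₚ (a ∷ f)) i ≈ coeff ((a ·ₚ g) +ₚ (0# ∷ (g *ₚ f))) i
    go zero g = begin
      coeff (g *ₚ (a ∷ f)) 0                  ≈⟨ coeff-*-zero g (a ∷ f) ⟩
      coeff g 0 * a                           ≈⟨ solve 2 (λ x a → x :* a := a :* x :+ con (+ 0)) refl _ a ⟩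
      a * coeff g 0 + 0#                      ≈⟨ sym (trans (coeff-+ (a ·ₚ g) (0# ∷ (g *ₚ f)) 0)
                                                            (+-congʳ (coeff-· a g 0))) ⟩
      coeff ((a ·ₚ g) +ₚ (0# ∷ (g *ₚ f))) 0   ∎
    go (suc i) g = begin
      coeff (g *ₚ (a ∷ f)) (suc i)
        ≈⟨ coeff-*-suc g (a ∷ f) i ⟩
      g₀ * coeff f i + coeff (tailₚ g *ₚ (a ∷ f)) i
        ≈⟨ +-congˡ (trans (go i (tailₚ g)) (trans (coeff-+ (a ·ₚ tailₚ g) (0# ∷ (tailₚ g *ₚ f)) i)
             (+-congʳ (trans (coeff-· a (tailₚ g) i) (*-congˡ (reflexive (coeff-tailₚ g i))))))) ⟩
      g₀ * coeff f i + (a * coeff g (suc i) + coeff (0# ∷ (tailₚ g *ₚ f)) i)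
        ≈⟨ regroup i ⟩
      a * coeff g (suc i) + coeff (g *ₚ f) i
        ≈⟨ sym (trans (coeff-+ (a ·ₚ g) (0# ∷ (g *ₚ f)) (suc i)) (+-congʳ (coeff-· a g (suc i)))) ⟩
      coeff ((a ·ₚ g) +ₚ (0# ∷ (g *ₚ f))) (suc i)
        ∎
      where
      g₀ = coeff g 0
      regroup : ∀ i → g₀ * coeff f i + (a * coeff g (suc i) + coeff (0# ∷ (tailₚ g *ₚ f)) i)
                      ≈ a * coeff g (suc i) + coeff (g *ₚ f) i
      regroup zero = trans (solve 2 (λ u v → u :+ (v :+ con (+ 0)) := v :+ u) refl _ _)
                           (+-congˡ (sym (coeff-*-zero g f)))
      regroup (suc j) = trans (solve 3 (λ u v w → u :+ (v :+ w) := v :+ (u :+ w)) refl _ _ _)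
                              (+-congˡ (sym (coeff-*-suc g f j)))

  *ₚ-comm : ∀ f g → (f *ₚ g) ≋ (g *ₚ f)
  *ₚ-comm []      g = ≋-sym (*ₚ-zeroʳ g)
  *ₚ-comm (a ∷ f) g = ≋-trans (+ₚ-congˡ (a ·ₚ g) (∷-cong refl (*ₚ-comm f g))) (≋-sym (*ₚ-∷ g a f))

  *ₚ-distribˡ : ∀ f g h → (f *ₚ (g +ₚ h)) ≋ ((f *ₚ g) +ₚ (f *ₚ h))
  *ₚ-distribˡ f g h = ≋-trans (*ₚ-comm f (g +ₚ h))
    (≋-trans (*ₚ-distribʳ f g h) (+ₚ-cong (*ₚ-comm g f) (*ₚ-comm h f)))

  0∷-*ₚ : ∀ f g → ((0# ∷ f) *ₚ g) ≋ (0# ∷ (f *ₚ g))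
  0∷-*ₚ f g = coeffwise λ i → trans (coeff-+ (0# ·ₚ g) (0# ∷ (f *ₚ g)) i)
    (trans (+-congʳ (trans (coeff-· 0# g i) (zeroˡ _))) (+-identityˡ _))

  *ₚ-assoc : ∀ f g h → ((f *ₚ g) *ₚ h) ≋ (f *ₚ (g *ₚ h))
  *ₚ-assoc []      g h = ≋-refl
  *ₚ-assoc (a ∷ f) g h = ≋-trans (*ₚ-distribʳ h (a ·ₚ g) (0# ∷ (f *ₚ g)))
    (+ₚ-cong (·ₚ-*ₚ-assoc a g h) (≋-trans (0∷-*ₚ (f *ₚ g) h) (∷-cong refl (*ₚ-assoc f g h))))

  *ₚ-identityˡ : ∀ f → (constP 1# *ₚ f) ≋ f
  *ₚ-identityˡ f = ≋-trans (+ₚ-cong (coeffwise λ i → trans (coeff-· 1# f i) (*-identityˡ _)) constP-0#)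
                           (+ₚ-identityʳ f)

  *ₚ-identityʳ : ∀ f → (f *ₚ constP 1#) ≋ f
  *ₚ-identityʳ f = ≋-trans (*ₚ-comm f (constP 1#)) (*ₚ-identityˡ f)

  polynomialRing : CommutativeRing c ℓ
  polynomialRing = record
    { Carrier = Poly ; _≈_ = _≋_ ; _+_ = _+ₚ_ ; _*_ = _*ₚ_ ; -_ = -ₚ_ ; 0# = [] ; 1# = constP 1#
    ; isCommutativeRing = record
      { isRing = record
        { +-isAbelianGroup = record
          { isGroup = record
            { isMonoid = record
              { isSemigroup = record
                { isMagma = record
                  { isEquivalence = record { refl = ≋-refl ; sym = ≋-sym ; trans = ≋-trans }
                  ; ∙-cong = +ₚ-cong }
                ; assoc = +ₚ-assoc }
              ; identity = (λ f → ≋-refl) , +ₚ-identityʳ }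
            ; inverse = +ₚ-inverseˡ , +ₚ-inverseʳ
            ; ⁻¹-cong = -ₚ-cong }
          ; comm = +ₚ-comm }
        ; *-cong = *ₚ-cong ; *-assoc = *ₚ-assoc
        ; *-identity = *ₚ-identityˡ , *ₚ-identityʳ
        ; distrib = *ₚ-distribˡ , *ₚ-distribʳ }
      ; *-comm = *ₚ-comm } }

  ·ₚ-as-*ₚ : ∀ k f → (k ·ₚ f) ≋ (constP k *ₚ f)
  ·ₚ-as-*ₚ k f = ≋-sym (≋-trans (+ₚ-congˡ (k ·ₚ f) constP-0#) (+ₚ-identityʳ _))

  constP-* : ∀ a b → constP (a * b) ≋ (constP a *ₚ constP b)
  constP-* a b = ∷-cong (sym (+-identityʳ _)) ≋-refl

  ^ₚ-cong : ∀ {f g} → f ≋ g → ∀ k → (f ^ₚ k) ≋ (g ^ₚ k)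
  ^ₚ-cong e zero    = ≋-refl
  ^ₚ-cong e (suc k) = *ₚ-cong e (^ₚ-cong e k)

  coeff-X*ₚ-zero : ∀ f → coeff (X *ₚ f) 0 ≈ 0#
  coeff-X*ₚ-zero f = trans (coeff-*-zero X f) (zeroˡ _)

  coeff-X*ₚ-suc : ∀ f i → coeff (X *ₚ f) (suc i) ≈ coeff f i
  coeff-X*ₚ-suc f i = trans (coeff-*-suc X f i)
    (trans (+-congʳ (zeroˡ _)) (trans (+-identityˡ _) (at (*ₚ-identityˡ f) i)))

  coeff-X^-*ₚ : ∀ m f j → coeff ((X ^ₚ m) *ₚ f) (j ℕ.+ m) ≈ coeff f j
  coeff-X^-*ₚ zero f j =
    trans (reflexive (≡.cong (coeff (constP 1# *ₚ f)) (ℕP.+-identityʳ j))) (at (*ₚ-identityˡ f) j)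
  coeff-X^-*ₚ (suc m) f j = begin
    coeff ((X ^ₚ suc m) *ₚ f) (j ℕ.+ suc m)   ≡⟨ ≡.cong (coeff ((X ^ₚ suc m) *ₚ f)) (ℕP.+-suc j m) ⟩
    coeff ((X ^ₚ suc m) *ₚ f) (suc (j ℕ.+ m)) ≈⟨ at (*ₚ-assoc X (X ^ₚ m) f) (suc (j ℕ.+ m)) ⟩
    coeff (X *ₚ ((X ^ₚ m) *ₚ f)) (suc (j ℕ.+ m)) ≈⟨ coeff-X*ₚ-suc ((X ^ₚ m) *ₚ f) (j ℕ.+ m) ⟩
    coeff ((X ^ₚ m) *ₚ f) (j ℕ.+ m)           ≈⟨ coeff-X^-*ₚ m f j ⟩
    coeff f j                                  ∎

  coeff-X-≥2 : ∀ i → 2 ≤ i → coeff X i ≈ 0#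
  coeff-X-≥2 (suc (suc i)) _           = refl
  coeff-X-≥2 (suc zero)    (s≤s ())

  coeff-X^-≡ : ∀ m → coeff (X ^ₚ m) m ≈ 1#
  coeff-X^-≡ zero    = refl
  coeff-X^-≡ (suc m) = trans (coeff-X*ₚ-suc (X ^ₚ m) m) (coeff-X^-≡ m)

  coeff-X^-≢ : ∀ m i → i ≢ m → coeff (X ^ₚ m) i ≈ 0#
  coeff-X^-≢ zero    zero    i≢m = ⊥-elim (i≢m ≡.refl)
  coeff-X^-≢ zero    (suc i) i≢m = refl
  coeff-X^-≢ (suc m) zero    i≢m = coeff-X*ₚ-zero (X ^ₚ m)
  coeff-X^-≢ (suc m) (suc i) i≢m =
    trans (coeff-X*ₚ-suc (X ^ₚ m) i) (coeff-X^-≢ m i (λ i≡m → i≢m (≡.cong suc i≡m)))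

  ∷-as-X : ∀ a f → (a ∷ f) ≋ (constP a +ₚ (X *ₚ f))
  ∷-as-X a f = coeffwise λ
    { zero    → sym (trans (coeff-+ (constP a) (X *ₚ f) 0)
                      (trans (+-congˡ (coeff-X*ₚ-zero f)) (+-identityʳ a)))
    ; (suc i) → sym (trans (coeff-+ (constP a) (X *ₚ f) (suc i))
                      (trans (+-identityˡ _) (coeff-X*ₚ-suc f i))) }

  DegreeBelow : ℕ → Poly → Set ℓ
  DegreeBelow d f = ∀ i → d ≤ i → coeff f i ≈ 0#

  DegreeBelow-cong : ∀ {d f g} → f ≋ g → DegreeBelow d f → DegreeBelow d g
  DegreeBelow-cong e deg i d≤i = trans (sym (at e i)) (deg i d≤i)

  DegreeBelow-0 : ∀ f → DegreeBelow 0 f → f ≋ []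
  DegreeBelow-0 f deg = coeffwise λ i → deg i z≤n

  DegreeBelow-1 : ∀ f → DegreeBelow 1 f → f ≋ constP (coeff f 0)
  DegreeBelow-1 f deg = coeffwise λ { zero → refl ; (suc i) → deg (suc i) (s≤s z≤n) }

  DegreeBelow-mono : ∀ {d e} f → d ≤ e → DegreeBelow d f → DegreeBelow e f
  DegreeBelow-mono f d≤e deg i e≤i = deg i (ℕP.≤-trans d≤e e≤i)

  DegreeBelow-− : ∀ {d} f h → DegreeBelow d f → DegreeBelow d h → DegreeBelow d (f +ₚ (-ₚ h))
  DegreeBelow-− f h degf degh i d≤i = trans (coeff-+ f (-ₚ h) i)
    (trans (+-cong (degf i d≤i) (trans (coeff-neg h i) (-‿cong (degh i d≤i)))) (trans (+-identityˡ _) -0#≈0#))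

  DegreeBelow-tailₚ : ∀ {d} f → DegreeBelow (suc d) f → DegreeBelow d (tailₚ f)
  DegreeBelow-tailₚ f deg i d≤i = trans (reflexive (coeff-tailₚ f i)) (deg (suc i) (s≤s d≤i))

  DegreeBelow-* : ∀ d e f g → DegreeBelow (suc d) f → DegreeBelow (suc e) g →
                  DegreeBelow (suc (d ℕ.+ e)) (f *ₚ g)
  DegreeBelow-* d e f g degf degg (suc i) (s≤s d+e≤i) = trans (coeff-*-suc f g i)
    (trans (+-cong (trans (*-congˡ (degg (suc i) (s≤s (ℕP.≤-trans (ℕP.m≤n+m e d) d+e≤i)))) (zeroʳ _))
                   (tail-product d degf d+e≤i))
           (+-identityʳ 0#))
    where
    tail-product : ∀ d → DegreeBelow (suc d) f → d ℕ.+ e ≤ i → coeff (tailₚ f *ₚ g) i ≈ 0#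
    tail-product zero     degf _      = at (*ₚ-congˡ g (DegreeBelow-0 (tailₚ f) (DegreeBelow-tailₚ f degf))) i
    tail-product (suc d′) degf d+e≤i  =
      DegreeBelow-* d′ e (tailₚ f) g (DegreeBelow-tailₚ f degf) degg i d+e≤i

  module Span {g} (G : Poly → Set g) where

    InSpan-cong : ∀ {f h} → f ≋ h → InSpan G f → InSpan G h
    InSpan-cong f≋h (L , gens , f≈L) = L , gens , λ i → trans (sym (at f≋h i)) (f≈L i)

    InSpan-[] : InSpan G []
    InSpan-[] = [] , [] , λ _ → refl

    InSpan-generator : ∀ k h → G h → InSpan G (k ·ₚ h)
    InSpan-generator k h Gh = ((k , h) ∷ []) , (Gh ∷ []) , at (≋-sym (+ₚ-identityʳ (k ·ₚ h)))

    linComb-++ : ∀ L M → linComb (L ++ M) ≋ (linComb L +ₚ linComb M)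
    linComb-++ []            M = ≋-refl
    linComb-++ ((k , h) ∷ L) M = ≋-trans (+ₚ-congˡ (k ·ₚ h) (linComb-++ L M))
                                         (≋-sym (+ₚ-assoc (k ·ₚ h) (linComb L) (linComb M)))

    InSpan-+ : ∀ f h → InSpan G f → InSpan G h → InSpan G (f +ₚ h)
    InSpan-+ f h (L , gensL , f≈L) (M , gensM , h≈M) = L ++ M , All.++⁺ gensL gensM ,
      at (≋-trans (+ₚ-cong (coeffwise {f} {linComb L} f≈L) (coeffwise {h} {linComb M} h≈M)) (≋-sym (linComb-++ L M)))

    InSpan-elim : ∀ {p} (P : Poly → Set p) → (∀ {f h} → f ≋ h → P f → P h) → P [] →
                  (∀ {f h} → P f → P h → P (f +ₚ h)) → (∀ k {h} → G h → P (k ·ₚ h)) →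
                  ∀ {f} → InSpan G f → P f
    InSpan-elim P P-cong P-[] P-+ P-gen {f} (L , gens , f≈L) =
      P-cong (≋-sym (coeffwise {f} {linComb L} f≈L)) (linear L gens)
      where
      linear : ∀ L → All (λ t → G (proj₂ t)) L → P (linComb L)
      linear []            []           = P-[]
      linear ((k , h) ∷ L) (Gh ∷ gens) = P-+ (P-gen k Gh) (linear L gens)

ℕ-cast : ∀ {c ℓ} (R : CommutativeRing c ℓ) → ℕ → CommutativeRing.Carrier R
ℕ-cast R n = Algebra.Properties.Semiring.Mult._×_ (CommutativeRing.semiring R) n (CommutativeRing.1# R)

CharacteristicDivides : ∀ {c ℓ} → CommutativeRing c ℓ → ℕ → Set ℓ
CharacteristicDivides R n = CommutativeRing._≈_ R (ℕ-cast R n) (CommutativeRing.0# R)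

module FieldProperties {c ℓ} (F : Field c ℓ) where
  open Field F hiding (setoid)
  open PolyOps F using (_^F_)
  open Algebra.Properties.Semiring.Mult semiring using (×1-homo-*)
  open IntegerCoefficients commutativeRing using (solve; _:*_; _:=_)
  open import Relation.Binary.Reasoning.Setoid (Field.setoid F)

  ι : ℕ → Carrier
  ι = ℕ-cast commutativeRing

  ι-* : ∀ m n → ι (m ℕ.* n) ≈ ι m * ι n
  ι-* = ×1-homo-*

  ι-^ : ∀ m k → ι (m ^ k) ≈ ι m ^F k
  ι-^ m zero    = +-identityʳ 1#
  ι-^ m (suc k) = trans (ι-* m (m ^ k)) (*-congˡ (ι-^ m k))

  nonzero*≈0⇒≈0 : ∀ {x y} → ¬ x ≈ 0# → x * y ≈ 0# → y ≈ 0#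
  nonzero*≈0⇒≈0 {x} {y} x≉0 xy≈0 with inverse x x≉0
  ... | x⁻¹ , xx⁻¹≈1 = begin
    y              ≈⟨ sym (*-identityˡ y) ⟩
    1# * y         ≈⟨ *-congʳ (sym xx⁻¹≈1) ⟩
    (x * x⁻¹) * y  ≈⟨ solve 3 (λ x x⁻¹ y → (x :* x⁻¹) :* y := x⁻¹ :* (x :* y)) refl x x⁻¹ y ⟩
    x⁻¹ * (x * y)  ≈⟨ *-congˡ xy≈0 ⟩
    x⁻¹ * 0#       ≈⟨ zeroʳ x⁻¹ ⟩
    0#             ∎

  *-nonzero : ∀ {x y} → ¬ x ≈ 0# → ¬ y ≈ 0# → ¬ x * y ≈ 0#
  *-nonzero x≉0 y≉0 xy≈0 = y≉0 (nonzero*≈0⇒≈0 x≉0 xy≈0)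

  ^F-nonzero : ∀ k {x} → ¬ x ≈ 0# → ¬ x ^F k ≈ 0#
  ^F-nonzero zero    x≉0 = 1≉0
  ^F-nonzero (suc k) x≉0 = *-nonzero x≉0 (^F-nonzero k x≉0)

  ι-zero⇒1+ab≢cd : ∀ a b c d → ι b ≈ 0# → ι d ≈ 0# → 1 ℕ.+ a ℕ.* b ≢ c ℕ.* d
  ι-zero⇒1+ab≢cd a b c d ιb≈0 ιd≈0 eq = 1≉0 (begin
    1#                  ≈⟨ sym (+-identityʳ 1#) ⟩
    1# + 0#             ≈⟨ +-congˡ (sym (trans (*-congˡ ιb≈0) (zeroʳ _))) ⟩
    1# + ι a * ι b      ≈⟨ +-congˡ (sym (ι-* a b)) ⟩
    ι (1 ℕ.+ a ℕ.* b)   ≡⟨ ≡.cong ι eq ⟩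
    ι (c ℕ.* d)         ≈⟨ ι-* c d ⟩
    ι c * ι d           ≈⟨ *-congˡ ιd≈0 ⟩
    ι c * 0#            ≈⟨ zeroʳ _ ⟩
    0#                  ∎)

  ι-nonzero : ∀ {p k} → Prime p → ι p ≈ 0# → 0 ℕ.< k → k ℕ.< p → ¬ ι k ≈ 0#
  ι-nonzero {p} {k@(suc _)} pr ιp≈0 _ k<p ιk≈0 with coprime-Bézout (prime⇒coprime pr k<p)
  ... | Bézout.+- x y 1+yk≡xp = ι-zero⇒1+ab≢cd y k x p ιk≈0 ιp≈0 1+yk≡xp
  ... | Bézout.-+ x y 1+xp≡yk = ι-zero⇒1+ab≢cd x p y k ιp≈0 ιk≈0 1+xp≡yk

module FiniteField {c ℓ} (F : Field c ℓ) {q : ℕ} (enum : Inverse (Field.setoid F) (setoid (Fin q))) where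
  open Field F hiding (setoid)
  open PolyOps F using (_^F_)
  open Inverse enum
  open FieldProperties F using (ι; ι-^; ^F-nonzero)
  open Algebra.Properties.CommutativeMonoid.Sum +-commutativeMonoid
    using (sum; sum-permute; ∑-distrib-+; sum-cong-≋; sum-replicate)
  open IntegerCoefficients commutativeRing using (solve; _:+_; :-_; _:-_; _:=_)
  open import Relation.Binary.Reasoning.Setoid (Field.setoid F)

  from-to : ∀ x → from (to x) ≈ x
  from-to x = inverseʳ ≡.refl

  _≟_ : ∀ x y → Dec (x ≈ y)
  x ≟ y with to x Fin.≟ to y
  ... | yes tx≡ty = yes (trans (sym (from-to x)) (trans (from-cong tx≡ty) (from-to y)))
  ... | no  tx≢ty = no (λ x≈y → tx≢ty (to-cong x≈y))

  -- Translation by 1 permutes the q elements, so Σ x = Σ (x + 1) = Σ x + q · 1.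
  ιq≈0 : ι q ≈ 0#
  ιq≈0 = begin
    ι q                                     ≈⟨ solve 2 (λ x S → x := (S :+ x) :- S) refl (ι q) S ⟩
    (S + ι q) - S                           ≈⟨ +-congʳ (+-congˡ (sym (sum-replicate q))) ⟩
    (S + sum {q} (λ _ → 1#)) - S            ≈⟨ +-congʳ (sym (∑-distrib-+ from (λ _ → 1#))) ⟩
    sum (λ i → from i + 1#) - S             ≈⟨ +-congʳ (sum-cong-≋ {q} (λ i → sym (from-to (from i + 1#)))) ⟩
    sum (λ i → from (succ i)) - S           ≈⟨ +-congʳ (sym (sum-permute from translation)) ⟩
    S - S                                   ≈⟨ -‿inverseʳ S ⟩
    0#                                      ∎
    where
    S = sum from
    succ pred : Fin q → Fin q
    succ i = to (from i + 1#)
    pred i = to (from i - 1#)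
    succ-pred : ∀ i → succ (pred i) ≡ i
    succ-pred i = inverseˡ (trans (+-congʳ (from-to _)) (solve 2 (λ x o → (x :- o) :+ o := x) refl (from i) 1#))
    pred-succ : ∀ i → pred (succ i) ≡ i
    pred-succ i = inverseˡ (trans (+-congʳ (from-to _)) (solve 2 (λ x o → (x :+ o) :- o := x) refl (from i) 1#))
    translation = permutation succ pred succ-pred pred-succ

  ι-base≈0 : ∀ {p n} → q ≡ p ^ n → ι p ≈ 0#
  ι-base≈0 {p} {n} q≡p^n with ι p ≟ 0#
  ... | yes ιp≈0 = ιp≈0
  ... | no  ιp≉0 = ⊥-elim (^F-nonzero n ιp≉0 (begin
    ι p ^F n  ≈⟨ sym (ι-^ p n) ⟩
    ι (p ^ n) ≡⟨ ≡.cong ι (≡.sym q≡p^n) ⟩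
    ι q       ≈⟨ ιq≈0 ⟩
    0#        ∎))

module Shift {c ℓ} (F : Field c ℓ) (r : Field.Carrier F) where
  open Field F hiding (setoid)
  open PolyOps F
  open PolynomialRing F
  open FieldProperties F using (ι)
  open IntegerCoefficients polynomialRing using (solve; _:+_; _:*_; :-_; _:=_)
  open IntegerCoefficients commutativeRing using () renaming (solve to solveF; _:+_ to _⊕_; _:*_ to _⊛_; _:=_ to _⊜_)
  open import Relation.Binary.Reasoning.Setoid (CommutativeRing.setoid polynomialRing)

  x+r : Poly
  x+r = X +ₚ constP r

  σ : Poly → Poly
  σ = shift r

  σ-zero : ∀ f → f ≋ [] → σ f ≋ []
  σ-zero []      _ = ≋-refl
  σ-zero (a ∷ f) e = +ₚ-cong {constP a} {[]}
    (coeffwise λ { zero → at e 0 ; (suc i) → refl })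
    (≋-trans (*ₚ-congʳ x+r (σ-zero f (tailₚ-cong e))) (*ₚ-zeroʳ x+r))

  σ-cong : ∀ {f g} → f ≋ g → σ f ≋ σ g
  σ-cong {[]}    {g}     e = ≋-sym (σ-zero g (≋-sym e))
  σ-cong {a ∷ f} {[]}    e = σ-zero (a ∷ f) e
  σ-cong {a ∷ f} {b ∷ g} e = +ₚ-cong (constP-cong (at e 0)) (*ₚ-congʳ x+r (σ-cong {f} {g} (tailₚ-cong e)))

  σ-+ : ∀ f g → σ (f +ₚ g) ≋ (σ f +ₚ σ g)
  σ-+ []      g       = ≋-refl
  σ-+ (a ∷ f) []      = ≋-sym (+ₚ-identityʳ _)
  σ-+ (a ∷ f) (b ∷ g) = begin
    constP (a + b) +ₚ (x+r *ₚ σ (f +ₚ g))         ≈⟨ +ₚ-congˡ (constP (a + b)) (*ₚ-congʳ x+r (σ-+ f g)) ⟩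
    (constP a +ₚ constP b) +ₚ (x+r *ₚ (σ f +ₚ σ g)) ≈⟨ solve 5 (λ A B l u v → (A :+ B) :+ l :* (u :+ v)
                                                         := (A :+ l :* u) :+ (B :+ l :* v))
                                                         ≋-refl (constP a) (constP b) x+r (σ f) (σ g) ⟩
    σ (a ∷ f) +ₚ σ (b ∷ g)                        ∎

  σ-· : ∀ k f → σ (k ·ₚ f) ≋ (k ·ₚ σ f)
  σ-· k []      = ≋-refl
  σ-· k (a ∷ f) = begin
    constP (k * a) +ₚ (x+r *ₚ σ (k ·ₚ f))
      ≈⟨ +ₚ-cong (constP-* k a) (*ₚ-congʳ x+r (≋-trans (σ-· k f) (·ₚ-as-*ₚ k (σ f)))) ⟩
    (constP k *ₚ constP a) +ₚ (x+r *ₚ (constP k *ₚ σ f)) ≈⟨ solve 4 (λ K A l u → K :* A :+ l :* (K :* u)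
                                                              := K :* (A :+ l :* u))
                                                              ≋-refl (constP k) (constP a) x+r (σ f) ⟩
    constP k *ₚ σ (a ∷ f)                                ≈⟨ ≋-sym (·ₚ-as-*ₚ k (σ (a ∷ f))) ⟩
    k ·ₚ σ (a ∷ f)                                       ∎

  σ-neg : ∀ f → σ (-ₚ f) ≋ (-ₚ σ f)
  σ-neg []      = ≋-refl
  σ-neg (a ∷ f) = ≋-trans (+ₚ-congˡ (constP (- a)) (*ₚ-congʳ x+r (σ-neg f)))
    (solve 3 (λ A l u → (:- A) :+ l :* (:- u) := :- (A :+ l :* u)) ≋-refl (constP a) x+r (σ f))

  σ-* : ∀ f g → σ (f *ₚ g) ≋ (σ f *ₚ σ g)
  σ-* []      g = ≋-refl
  σ-* (a ∷ f) g = begin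
    σ ((a ·ₚ g) +ₚ (0# ∷ (f *ₚ g)))                          ≈⟨ σ-+ (a ·ₚ g) (0# ∷ (f *ₚ g)) ⟩
    σ (a ·ₚ g) +ₚ (constP 0# +ₚ (x+r *ₚ σ (f *ₚ g)))
      ≈⟨ +ₚ-cong (≋-trans (σ-· a g) (·ₚ-as-*ₚ a (σ g))) (+ₚ-cong constP-0# (*ₚ-congʳ x+r (σ-* f g))) ⟩
    (constP a *ₚ σ g) +ₚ ([] +ₚ (x+r *ₚ (σ f *ₚ σ g)))
      ≈⟨ solve 4 (λ A u l v → A :* u :+ l :* (v :* u) := (A :+ l :* v) :* u) ≋-refl (constP a) (σ g) x+r (σ f) ⟩
    σ (a ∷ f) *ₚ σ g
      ∎

  σ-constP : ∀ a → σ (constP a) ≋ constP a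
  σ-constP a = ≋-trans (+ₚ-congˡ (constP a) (*ₚ-zeroʳ x+r)) (+ₚ-identityʳ (constP a))

  σ-X : σ X ≋ x+r
  σ-X = begin
    constP 0# +ₚ (x+r *ₚ σ (constP 1#)) ≈⟨ +ₚ-cong constP-0# (*ₚ-congʳ x+r (σ-constP 1#)) ⟩
    x+r *ₚ constP 1#                    ≈⟨ *ₚ-identityʳ x+r ⟩
    x+r                                 ∎

  σ-^ : ∀ f k → σ (f ^ₚ k) ≋ (σ f ^ₚ k)
  σ-^ f zero    = σ-constP 1#
  σ-^ f (suc k) = ≋-trans (σ-* f (f ^ₚ k)) (*ₚ-congʳ (σ f) (σ-^ f k))

  eval≈coeff-σ : ∀ f → eval f r ≈ coeff (σ f) 0
  eval≈coeff-σ []      = refl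
  eval≈coeff-σ (a ∷ f) = sym (trans (coeff-+ (constP a) (x+r *ₚ σ f) 0)
    (+-congˡ (trans (coeff-*-zero x+r (σ f)) (*-cong (+-identityˡ r) (sym (eval≈coeff-σ f))))))

  coeff-σ-zero : ∀ a f → coeff (σ (a ∷ f)) 0 ≈ a + r * coeff (σ f) 0
  coeff-σ-zero a f = trans (coeff-+ (constP a) (x+r *ₚ σ f) 0)
    (+-congˡ (trans (coeff-*-zero x+r (σ f)) (*-congʳ (+-identityˡ r))))

  coeff-σ-suc : ∀ a f i → coeff (σ (a ∷ f)) (suc i) ≈ coeff (σ f) i + r * coeff (σ f) (suc i)
  coeff-σ-suc a f i = trans (coeff-+ (constP a) (x+r *ₚ σ f) (suc i))
    (trans (+-identityˡ _) (trans (coeff-*-suc x+r (σ f) i)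
      (trans (+-cong (*-congʳ (+-identityˡ r)) (at (*ₚ-identityˡ (σ f)) i)) (+-comm _ _))))

  σ-DegreeBelow : ∀ d f → DegreeBelow d f → DegreeBelow d (σ f)
  σ-DegreeBelow d       []      deg i _ = refl
  σ-DegreeBelow zero    (a ∷ f) deg i _ = at (σ-zero (a ∷ f) (DegreeBelow-0 (a ∷ f) deg)) i
  σ-DegreeBelow (suc d) (a ∷ f) deg (suc i) (s≤s d≤i) = trans (coeff-σ-suc a f i)
    (trans (+-cong (degσf i d≤i) (*-congˡ (degσf (suc i) (ℕP.m≤n⇒m≤1+n d≤i))))
           (trans (+-identityˡ _) (zeroʳ r)))
    where degσf = σ-DegreeBelow d f (DegreeBelow-tailₚ (a ∷ f) deg)

  coeff-σ-top : ∀ f e → DegreeBelow (suc (suc e)) f →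
    coeff (σ f) (suc e) ≈ coeff f (suc e) ×
    coeff (σ f) e ≈ coeff f e + ι (suc e) * (r * coeff f (suc e))
  coeff-σ-top []      e deg = refl , sym (trans (+-congˡ (trans (*-congˡ (zeroʳ r)) (zeroʳ _))) (+-identityʳ 0#))
  coeff-σ-top (a ∷ f) zero deg = top , below
    where
    degf = DegreeBelow-tailₚ (a ∷ f) deg
    σf₀≈f₀ : coeff (σ f) 0 ≈ coeff f 0
    σf₀≈f₀ = at (≋-trans (σ-cong (DegreeBelow-1 f degf)) (σ-constP (coeff f 0))) 0
    top : coeff (σ (a ∷ f)) 1 ≈ coeff f 0
    top = trans (coeff-σ-suc a f 0)
      (trans (+-cong σf₀≈f₀ (trans (*-congˡ (σ-DegreeBelow 1 f degf 1 ℕP.≤-refl)) (zeroʳ r))) (+-identityʳ _))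
    below : coeff (σ (a ∷ f)) 0 ≈ a + ι 1 * (r * coeff f 0)
    below = trans (coeff-σ-zero a f)
      (+-congˡ (trans (*-congˡ σf₀≈f₀) (sym (trans (*-congʳ (+-identityʳ 1#)) (*-identityˡ _)))))
  coeff-σ-top (a ∷ f) (suc e) deg = top , below
    where
    degf = DegreeBelow-tailₚ (a ∷ f) deg
    ih = coeff-σ-top f e degf
    top : coeff (σ (a ∷ f)) (suc (suc e)) ≈ coeff f (suc e)
    top = trans (coeff-σ-suc a f (suc e))
      (trans (+-cong (proj₁ ih) (trans (*-congˡ (σ-DegreeBelow _ f degf _ ℕP.≤-refl)) (zeroʳ r)))
             (+-identityʳ _))
    below : coeff (σ (a ∷ f)) (suc e) ≈ coeff f e + ι (suc (suc e)) * (r * coeff f (suc e))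
    below = trans (coeff-σ-suc a f e) (trans (+-cong (proj₂ ih) (*-congˡ (proj₁ ih)))
      (trans (+-congˡ (sym (*-identityˡ _)))
        (solveF 5 (λ x i r y o → (x ⊕ i ⊛ (r ⊛ y)) ⊕ o ⊛ (r ⊛ y) ⊜ x ⊕ (o ⊕ i) ⊛ (r ⊛ y))
          refl (coeff f e) (ι (suc e)) r (coeff f (suc e)) 1#)))

prime∤! : ∀ {p m} → Prime p → m ℕ.< p → ¬ p ∣ m ℕ.!
prime∤! {p} {zero} pr _ p∣1 = ℕP.<-irrefl ≡.refl
  (ℕP.<-≤-trans (nonTrivial⇒n>1 p {{prime⇒nonTrivial pr}}) (∣⇒≤ p∣1))
prime∤! {p} {suc m} pr m<p p∣m! with euclidsLemma (suc m) (m ℕ.!) pr p∣m!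
... | inj₁ p∣1+m = >⇒∤ m<p p∣1+m
... | inj₂ p∣m!  = prime∤! pr (ℕP.<-trans (ℕP.n<1+n m) m<p) p∣m!

k!*[n∸k]!*nCk≡n! : ∀ {n k} → k ≤ n → (k ℕ.! ℕ.* (n ∸ k) ℕ.!) ℕ.* (n C k) ≡ n ℕ.!
k!*[n∸k]!*nCk≡n! {n} {k} k≤n =
  ≡.trans (≡.cong ((k ℕ.! ℕ.* (n ∸ k) ℕ.!) ℕ.*_) (nCk≡n!/k![n-k]! k≤n))
          (m*[n/m]≡n {{k !* (n ∸ k) !≢0}} (k![n∸k]!∣n! k≤n))

prime∣binomial : ∀ {p k} → Prime p → 0 ℕ.< k → k ℕ.< p → p ∣ p C k
prime∣binomial {p@(suc p′)} {k} pr 0<k k<p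
  with euclidsLemma (k ℕ.! ℕ.* (p ∸ k) ℕ.!) (p C k) pr
         (≡.subst (p ∣_) (≡.sym (k!*[n∸k]!*nCk≡n! (ℕP.<⇒≤ k<p))) (m∣m*n (p′ ℕ.!)))
... | inj₂ p∣pCk = p∣pCk
... | inj₁ p∣k!*[p∸k]! with euclidsLemma (k ℕ.!) ((p ∸ k) ℕ.!) pr p∣k!*[p∸k]!
...   | inj₁ p∣k!     = ⊥-elim (prime∤! pr k<p p∣k!)
...   | inj₂ p∣[p∸k]! = ⊥-elim (prime∤! pr (ℕP.∸-monoʳ-< 0<k (ℕP.<⇒≤ k<p)) p∣[p∸k]!)

n<m^n : ∀ {m} → 1 ℕ.< m → ∀ n → n ℕ.< m ^ n
n<m^n 1<m zero    = s≤s z≤n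
n<m^n 1<m (suc n) = ℕP.≤-<-trans (n<m^n 1<m n) (ℕP.^-monoʳ-< _ 1<m (ℕP.n<1+n n))

module PrimeCharacteristic {c ℓ} (R : CommutativeRing c ℓ) {p′ : ℕ} (prime : Prime (suc p′))
  (char : CharacteristicDivides R (suc p′)) where

  open CommutativeRing R hiding (setoid)
  open Algebra.Properties.Semiring.Mult semiring using (×-congʳ; ×-assoc-*; ×-assocˡ) renaming (_×_ to _×ₙ_)
  open Algebra.Properties.Semiring.Exp semiring using (^-congˡ; ^-assocʳ) renaming (_^_ to _^ᴿ_)
  open Algebra.Properties.Semiring.Sum semiring using (sum)
  open Algebra.Properties.CommutativeSemiring.Binomial commutativeSemiring using (theorem; binomialTerm)
  open import Relation.Binary.Reasoning.Setoid (CommutativeRing.setoid R)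

  p : ℕ
  p = suc p′

  p×≈0 : ∀ x → p ×ₙ x ≈ 0#
  p×≈0 x = begin
    p ×ₙ x          ≈⟨ ×-congʳ p (sym (*-identityˡ x)) ⟩
    p ×ₙ (1# * x)   ≈⟨ sym (×-assoc-* p 1# x) ⟩
    (p ×ₙ 1#) * x   ≈⟨ *-congʳ char ⟩
    0# * x          ≈⟨ zeroˡ x ⟩
    0#              ∎

  binomial×≈0 : ∀ {k} → 0 ℕ.< k → k ℕ.< p → ∀ x → (p C k) ×ₙ x ≈ 0#
  binomial×≈0 {k} 0<k k<p x with prime∣binomial prime 0<k k<p
  ... | divides d pCk≡d*p = begin
    (p C k) ×ₙ x        ≡⟨ ≡.cong (_×ₙ x) (≡.trans pCk≡d*p (ℕP.*-comm d p)) ⟩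
    (p ℕ.* d) ×ₙ x      ≈⟨ sym (×-assocˡ x p d) ⟩
    p ×ₙ (d ×ₙ x)       ≈⟨ p×≈0 (d ×ₙ x) ⟩
    0#                  ∎

  sum-last : ∀ m (t : Fin (suc m) → Carrier) → (∀ i → t (Fin.inject₁ i) ≈ 0#) →
             sum t ≈ t (Fin.fromℕ m)
  sum-last zero    t t≈0 = +-identityʳ (t Fin.zero)
  sum-last (suc m) t t≈0 =
    trans (+-cong (t≈0 Fin.zero) (sum-last m (λ i → t (Fin.suc i)) (λ i → t≈0 (Fin.suc i))))
          (+-identityˡ _)

  frobenius : ∀ x y → (x + y) ^ᴿ p ≈ x ^ᴿ p + y ^ᴿ p
  frobenius x y = begin
    (x + y) ^ᴿ p                          ≈⟨ theorem p x y ⟩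
    t Fin.zero + sum (λ i → t (Fin.suc i)) ≈⟨ +-cong first (sum-last p′ (λ i → t (Fin.suc i)) middle) ⟩
    y ^ᴿ p + t (Fin.suc (Fin.fromℕ p′))   ≈⟨ +-congˡ last ⟩
    y ^ᴿ p + x ^ᴿ p                       ≈⟨ +-comm _ _ ⟩
    x ^ᴿ p + y ^ᴿ p                       ∎
    where
    t = binomialTerm x y p
    first : t Fin.zero ≈ y ^ᴿ p
    first = trans (+-identityʳ _) (*-identityˡ _)
    middle : ∀ i → t (Fin.suc (Fin.inject₁ i)) ≈ 0#
    middle i = binomial×≈0 (s≤s z≤n)
      (s≤s (ℕP.≤-trans (s≤s (ℕP.≤-reflexive (Fin.toℕ-inject₁ i))) (Fin.toℕ<n i))) _
    last : t (Fin.suc (Fin.fromℕ p′)) ≈ x ^ᴿ p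
    last rewrite Fin.toℕ-fromℕ p′ | nCn≡1 p | ℕP.n∸n≡0 p′ = trans (+-identityʳ _) (*-identityʳ _)

  frobenius-^ : ∀ k x y → (x + y) ^ᴿ (p ^ k) ≈ x ^ᴿ (p ^ k) + y ^ᴿ (p ^ k)
  frobenius-^ zero    x y = trans (*-identityʳ _) (sym (+-cong (*-identityʳ x) (*-identityʳ y)))
  frobenius-^ (suc k) x y = begin
    (x + y) ^ᴿ (p ℕ.* p ^ k)                    ≈⟨ ^-by-p (x + y) ⟩
    ((x + y) ^ᴿ (p ^ k)) ^ᴿ p                   ≈⟨ ^-congˡ p (frobenius-^ k x y) ⟩
    (x ^ᴿ (p ^ k) + y ^ᴿ (p ^ k)) ^ᴿ p          ≈⟨ frobenius _ _ ⟩
    (x ^ᴿ (p ^ k)) ^ᴿ p + (y ^ᴿ (p ^ k)) ^ᴿ p   ≈⟨ sym (+-cong (^-by-p x) (^-by-p y)) ⟩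
    x ^ᴿ (p ℕ.* p ^ k) + y ^ᴿ (p ℕ.* p ^ k)     ∎
    where
    ^-by-p : ∀ z → z ^ᴿ (p ℕ.* p ^ k) ≈ (z ^ᴿ (p ^ k)) ^ᴿ p
    ^-by-p z = trans (reflexive (≡.cong (z ^ᴿ_) (ℕP.*-comm p (p ^ k)))) (sym (^-assocʳ z (p ^ k) p))

module Eigenspace {c ℓ} (F : Field c ℓ) {p′ : ℕ} (prime : Prime (suc p′))
  (char : CharacteristicDivides (Field.commutativeRing F) (suc p′))
  (r : Field.Carrier F) (r≉0 : ¬ Field._≈_ F r (Field.0# F)) where

  open Field F hiding (setoid)
  open FieldProperties F using (ι)
  open PolyOps F
  open PolynomialRing F
  open Shift F r
  open FieldProperties F using (nonzero*≈0⇒≈0; ι-nonzero)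
  open Algebra.Properties.Semiring.Mult (CommutativeRing.semiring polynomialRing)
    using () renaming (_×_ to _×ₚ_)
  open Algebra.Properties.Semiring.Exp (CommutativeRing.semiring polynomialRing)
    using (^-assocʳ) renaming (_^_ to _^ᴿ_)
  open Algebra.Properties.CommutativeSemiring.Exp (CommutativeRing.commutativeSemiring polynomialRing)
    using (^-distrib-*)
  open import Algebra.Properties.Ring ring using (-0#≈0#; -‿distribˡ-*)
  open IntegerCoefficients commutativeRing using (solve; _:+_; _:*_; _:-_; _:=_; con)
  open IntegerCoefficients polynomialRing using ()
    renaming (solve to solveₚ; _:+_ to _⊕_; _:*_ to _⊛_; :-_ to ⊝_; _:-_ to _⊖_; _:=_ to _⊜_)
  open import Relation.Binary.Reasoning.Setoid (Field.setoid F)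

  p : ℕ
  p = suc p′

  1≤p′ : 1 ≤ p′
  1≤p′ = ℕP.≤-pred (nonTrivial⇒n>1 p {{prime⇒nonTrivial prime}})

  ×ₚ-constP : ∀ m → (m ×ₚ constP 1#) ≋ constP (ι m)
  ×ₚ-constP zero    = ≋-sym constP-0#
  ×ₚ-constP (suc m) = +ₚ-congˡ (constP 1#) (×ₚ-constP m)

  ^ᴿ≡^ₚ : ∀ f k → f ^ᴿ k ≡ f ^ₚ k
  ^ᴿ≡^ₚ f zero    = ≡.refl
  ^ᴿ≡^ₚ f (suc k) = ≡.cong (f *ₚ_) (^ᴿ≡^ₚ f k)

  ^ₚ-assoc : ∀ f j k → ((f ^ₚ j) ^ₚ k) ≋ (f ^ₚ (j ℕ.* k))
  ^ₚ-assoc f j k = ≡.subst₂ _≋_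
    (≡.trans (^ᴿ≡^ₚ (f ^ᴿ j) k) (≡.cong (_^ₚ k) (^ᴿ≡^ₚ f j))) (^ᴿ≡^ₚ f (j ℕ.* k)) (^-assocʳ f j k)

  *ₚ-^ₚ : ∀ f h k → ((f *ₚ h) ^ₚ k) ≋ ((f ^ₚ k) *ₚ (h ^ₚ k))
  *ₚ-^ₚ f h k = ≡.subst₂ _≋_
    (^ᴿ≡^ₚ (f *ₚ h) k) (≡.cong₂ _*ₚ_ (^ᴿ≡^ₚ f k) (^ᴿ≡^ₚ h k)) (^-distrib-* f h k)

  open PrimeCharacteristic polynomialRing prime (≋-trans (×ₚ-constP p) (≋-trans (constP-cong char) constP-0#))
    using (frobenius-^)

  constP-^ : ∀ a k → (constP a ^ₚ k) ≋ constP (a ^F k)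
  constP-^ a zero    = ≋-refl
  constP-^ a (suc k) = ≋-trans (*ₚ-congʳ (constP a) (constP-^ a k)) (≋-sym (constP-* a (a ^F k)))

  frobeniusₚ : ∀ k f h → ((f +ₚ h) ^ₚ (p ^ k)) ≋ ((f ^ₚ (p ^ k)) +ₚ (h ^ₚ (p ^ k)))
  frobeniusₚ k f h = ≡.subst₂ _≋_
    (^ᴿ≡^ₚ (f +ₚ h) (p ^ k)) (≡.cong₂ _+ₚ_ (^ᴿ≡^ₚ f (p ^ k)) (^ᴿ≡^ₚ h (p ^ k))) (frobenius-^ k f h)

  σ-X^p^ : ∀ k → σ (X ^ₚ (p ^ k)) ≋ ((X ^ₚ (p ^ k)) +ₚ constP (r ^F (p ^ k)))
  σ-X^p^ k = ≋-trans (σ-^ X (p ^ k)) (≋-trans (^ₚ-cong σ-X (p ^ k))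
    (≋-trans (frobeniusₚ k X (constP r)) (+ₚ-congˡ (X ^ₚ (p ^ k)) (constP-^ r (p ^ k)))))

  σ-X^p : σ (X ^ₚ p) ≋ ((X ^ₚ p) +ₚ constP (r ^F p))
  σ-X^p = ≡.subst (λ m → σ (X ^ₚ m) ≋ ((X ^ₚ m) +ₚ constP (r ^F m))) (ℕP.*-identityʳ p) (σ-X^p^ 1)

  b : Carrier
  b = r ^F p′

  g : Poly
  g = (X ^ₚ p) +ₚ (-ₚ (b ·ₚ X))

  -ₚ-·ₚ : ∀ k f → (-ₚ (k ·ₚ f)) ≋ ((- k) ·ₚ f)
  -ₚ-·ₚ k f = coeffwise λ i → trans (coeff-neg (k ·ₚ f) i)
    (trans (-‿cong (coeff-· k f i)) (trans (-‿distribˡ-* k _) (sym (coeff-· (- k) f i))))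

  g≋ : g ≋ ((X ^ₚ p) +ₚ (constP (- b) *ₚ X))
  g≋ = +ₚ-congˡ (X ^ₚ p) (≋-trans (-ₚ-·ₚ b X) (·ₚ-as-*ₚ (- b) X))

  -- σ g = (x + r)^p - b (x + r) = x^p - b x + (r^p - b r), and r^p = r b.
  σ-g : σ g ≋ g
  σ-g = ≋-trans (σ-cong g≋) (≋-trans (σ-+ (X ^ₚ p) (constP (- b) *ₚ X))
    (≋-trans (+ₚ-cong (≋-trans σ-X^p (+ₚ-congˡ (X ^ₚ p) (constP-* r b)))
                      (≋-trans (σ-* (constP (- b)) X) (*ₚ-cong (σ-constP (- b)) σ-X)))
    (≋-trans (solveₚ 4 (λ xᵖ R B x → (xᵖ ⊕ R ⊛ B) ⊕ (⊝ B) ⊛ (x ⊕ R) ⊜ xᵖ ⊕ (⊝ B) ⊛ x)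
                       ≋-refl (X ^ₚ p) (constP r) (constP b) X)
             (≋-sym g≋))))

  coeff-g*ₚ : ∀ f j → coeff (g *ₚ f) (j ℕ.+ p) ≈ coeff f j - b * coeff f (j ℕ.+ p′)
  coeff-g*ₚ f j = begin
    coeff (g *ₚ f) (j ℕ.+ p)
      ≈⟨ at (*ₚ-congˡ f g≋) (j ℕ.+ p) ⟩
    coeff (((X ^ₚ p) +ₚ (constP (- b) *ₚ X)) *ₚ f) (j ℕ.+ p)
      ≈⟨ trans (at (*ₚ-distribʳ f (X ^ₚ p) (constP (- b) *ₚ X)) (j ℕ.+ p))
               (coeff-+ ((X ^ₚ p) *ₚ f) ((constP (- b) *ₚ X) *ₚ f) (j ℕ.+ p)) ⟩
    coeff ((X ^ₚ p) *ₚ f) (j ℕ.+ p) + coeff ((constP (- b) *ₚ X) *ₚ f) (j ℕ.+ p)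
      ≈⟨ +-cong (coeff-X^-*ₚ p f j) (at (≋-trans (*ₚ-assoc (constP (- b)) X f)
                                               (≋-sym (·ₚ-as-*ₚ (- b) (X *ₚ f)))) (j ℕ.+ p)) ⟩
    coeff f j + coeff ((- b) ·ₚ (X *ₚ f)) (j ℕ.+ p)
      ≈⟨ +-congˡ (trans (coeff-· (- b) (X *ₚ f) (j ℕ.+ p)) (*-congˡ x*ₚ-shift)) ⟩
    coeff f j + (- b) * coeff f (j ℕ.+ p′)
      ≈⟨ +-congˡ (sym (-‿distribˡ-* b _)) ⟩
    coeff f j - b * coeff f (j ℕ.+ p′)
      ∎
    where
    x*ₚ-shift : coeff (X *ₚ f) (j ℕ.+ p) ≈ coeff f (j ℕ.+ p′)
    x*ₚ-shift = trans (reflexive (≡.cong (coeff (X *ₚ f)) (ℕP.+-suc j p′))) (coeff-X*ₚ-suc f (j ℕ.+ p′))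

  -- Read downwards from beyond the length of f, the recurrence of coeff-g*ₚ forces f_j = 0.
  g*ₚ-DegreeBelow⁻¹ : ∀ N f → DegreeBelow (N ℕ.+ p) (g *ₚ f) → DegreeBelow N f
  g*ₚ-DegreeBelow⁻¹ N f deg j N≤j = go (length f) j N≤j (ℕP.m≤n+m (length f) j)
    where
    go : ∀ t j → N ≤ j → length f ≤ j ℕ.+ t → coeff f j ≈ 0#
    go zero    j N≤j len≤j = coeff-≥length f j (ℕP.≤-trans len≤j (ℕP.≤-reflexive (ℕP.+-identityʳ j)))
    go (suc t) j N≤j len≤j+1+t = begin
      coeff f j                                        ≈⟨ solve 3 (λ x b y → x := (x :- b :* y) :+ b :* y)
                                                            refl (coeff f j) b (coeff f (j ℕ.+ p′)) ⟩
      (coeff f j - b * coeff f (j ℕ.+ p′)) + b * coeff f (j ℕ.+ p′)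
        ≈⟨ +-cong (trans (sym (coeff-g*ₚ f j)) (deg (j ℕ.+ p) (ℕP.+-monoˡ-≤ p N≤j))) (*-congˡ later) ⟩
      0# + b * 0#                                      ≈⟨ trans (+-identityˡ _) (zeroʳ b) ⟩
      0#                                               ∎
      where
      later : coeff f (j ℕ.+ p′) ≈ 0#
      later = go t (j ℕ.+ p′) (ℕP.≤-trans N≤j (ℕP.m≤m+n j p′))
        (ℕP.≤-trans len≤j+1+t (ℕP.≤-trans (ℕP.≤-reflexive (≡.sym (ℕP.+-assoc j 1 t)))
                                          (ℕP.+-monoˡ-≤ t (ℕP.+-monoʳ-≤ j 1≤p′))))

  record DivisionByG (h : Poly) : Set (c ⊔ ℓ) where
    constructor division
    field
      remainder quotient : Poly
      remainder-degree   : DegreeBelow p remainder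
      h≋remainder+g*quotient : h ≋ (remainder +ₚ (g *ₚ quotient))

  divide-by-g : ∀ h → DivisionByG h
  divide-by-g []      = division [] [] (λ _ _ → refl) (≋-sym (*ₚ-zeroʳ g))
  divide-by-g (a ∷ h) with divide-by-g h
  ... | division R′ Q′ degR′ h≋ = division R Q degR a∷h≋
    where
    -- R′ has degree < p, so x R′ has degree ≤ p; subtracting top · g removes its x^p term.
    top = coeff R′ p′
    R = (constP a +ₚ ((X *ₚ R′) +ₚ (-ₚ (top ·ₚ (X ^ₚ p))))) +ₚ ((top * b) ·ₚ X)
    Q = constP top +ₚ (X *ₚ Q′)

    a∷h≋ : (a ∷ h) ≋ (R +ₚ (g *ₚ Q))
    a∷h≋ = ≋-trans (∷-as-X a h) (≋-trans
      (+ₚ-congˡ (constP a) (*ₚ-congʳ X (≋-trans h≋ (+ₚ-congˡ R′ (*ₚ-congˡ Q′ g≋)))))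
      (≋-trans (solveₚ 7 (λ A x r′ xᵖ B q′ T →
                  A ⊕ x ⊛ (r′ ⊕ (xᵖ ⊕ (⊝ B) ⊛ x) ⊛ q′)
               ⊜ ((A ⊕ (x ⊛ r′ ⊕ (⊝ (T ⊛ xᵖ)))) ⊕ (T ⊛ B) ⊛ x)
                 ⊕ (xᵖ ⊕ (⊝ B) ⊛ x) ⊛ (T ⊕ x ⊛ q′))
               ≋-refl (constP a) X R′ (X ^ₚ p) (constP b) Q′ (constP top))
      (≋-sym (+ₚ-cong R≋ (*ₚ-congˡ Q g≋)))))
      where
      R≋ : R ≋ ((constP a +ₚ ((X *ₚ R′) +ₚ (-ₚ (constP top *ₚ (X ^ₚ p)))))
                +ₚ ((constP top *ₚ constP b) *ₚ X))
      R≋ = +ₚ-cong (+ₚ-congˡ (constP a) (+ₚ-congˡ (X *ₚ R′) (-ₚ-cong (·ₚ-as-*ₚ top (X ^ₚ p)))))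
                   (≋-trans (·ₚ-as-*ₚ (top * b) X) (*ₚ-congˡ X (constP-* top b)))

    coeff-R : ∀ i → coeff R (suc i) ≈ (coeff R′ i - top * coeff (X ^ₚ p) (suc i)) + (top * b) * coeff X (suc i)
    coeff-R i = trans (coeff-+ (constP a +ₚ ((X *ₚ R′) +ₚ (-ₚ (top ·ₚ (X ^ₚ p))))) ((top * b) ·ₚ X) (suc i))
      (+-cong (trans (coeff-+ (constP a) ((X *ₚ R′) +ₚ (-ₚ (top ·ₚ (X ^ₚ p)))) (suc i))
                (trans (+-identityˡ _) (trans (coeff-+ (X *ₚ R′) (-ₚ (top ·ₚ (X ^ₚ p))) (suc i))
                  (+-cong (coeff-X*ₚ-suc R′ i)
                          (trans (coeff-neg (top ·ₚ (X ^ₚ p)) (suc i)) (-‿cong (coeff-· top (X ^ₚ p) (suc i))))))))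
              (coeff-· (top * b) X (suc i)))

    degR : DegreeBelow p R
    degR (suc i) (s≤s p′≤i) with i ℕ.≟ p′
    ... | yes ≡.refl = trans (coeff-R i) (begin
      (top - top * coeff (X ^ₚ p) p) + (top * b) * coeff X p
        ≈⟨ +-cong (+-congˡ (-‿cong (*-congˡ (coeff-X^-≡ p)))) (*-congˡ (coeff-X-≥2 (suc i) (s≤s (ℕP.≤-trans 1≤p′ p′≤i)))) ⟩
      (top - top * 1#) + (top * b) * 0#
        ≈⟨ +-cong (+-congˡ (-‿cong (*-identityʳ top))) (zeroʳ _) ⟩
      (top - top) + 0#
        ≈⟨ trans (+-identityʳ _) (-‿inverseʳ top) ⟩
      0#
        ∎)
    ... | no i≢p′ = trans (coeff-R i) (begin
      (coeff R′ i - top * coeff (X ^ₚ p) (suc i)) + (top * b) * coeff X (suc i)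
        ≈⟨ +-cong (+-cong (degR′ i (ℕP.≤∧≢⇒< p′≤i (λ e → i≢p′ (≡.sym e))))
                          (-‿cong (*-congˡ (coeff-X^-≢ p (suc i) (λ e → i≢p′ (ℕP.suc-injective e))))))
                  (*-congˡ (coeff-X-≥2 (suc i) (s≤s (ℕP.≤-trans 1≤p′ p′≤i)))) ⟩
      (0# - top * 0#) + (top * b) * 0#
        ≈⟨ solve 2 (λ t u → (con (+ 0) :- t :* con (+ 0)) :+ u :* con (+ 0) := con (+ 0)) refl top (top * b) ⟩
      0# ∎)

  -- By coeff-σ-top, σ R = R forces (e + 1) r R_{e+1} = 0 below the top coefficient,
  -- and (e + 1) · 1 ≠ 0 as long as e + 1 < p.
  σ-fixed∧DegreeBelow-p⇒constant : ∀ R → DegreeBelow p R → σ R ≋ R → R ≋ constP (coeff R 0)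
  σ-fixed∧DegreeBelow-p⇒constant R degR σR≋R = DegreeBelow-1 R (lower p′ 0 (ℕP.+-identityʳ p′))
    where
    lower-once : ∀ e → suc e ℕ.< p → DegreeBelow (suc (suc e)) R → DegreeBelow (suc e) R
    lower-once e 1+e<p deg i 1+e≤i with i ℕ.≟ suc e
    ... | no i≢1+e = deg i (ℕP.≤∧≢⇒< 1+e≤i (λ e≡i → i≢1+e (≡.sym e≡i)))
    ... | yes ≡.refl = nonzero*≈0⇒≈0 r≉0 (nonzero*≈0⇒≈0 (ι-nonzero prime char (s≤s z≤n) 1+e<p) (begin
      ι (suc e) * (r * coeff R (suc e))       ≈⟨ solve 2 (λ x t → t := (x :+ t) :- x) refl (coeff R e) _ ⟩
      (coeff R e + ι (suc e) * (r * coeff R (suc e))) - coeff R e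
        ≈⟨ +-congʳ (trans (sym (proj₂ (coeff-σ-top R e deg))) (at σR≋R e)) ⟩
      coeff R e - coeff R e                   ≈⟨ -‿inverseʳ _ ⟩
      0#                                      ∎))
    lower : ∀ m d → m ℕ.+ d ≡ p′ → DegreeBelow (suc d) R
    lower zero    d eq = ≡.subst (λ d → DegreeBelow (suc d) R) (≡.sym eq) degR
    lower (suc m) d eq = lower-once d (s≤s (ℕP.≤-trans (s≤s (ℕP.m≤n+m d m)) (ℕP.≤-reflexive eq)))
                                      (lower m (suc d) (≡.trans (ℕP.+-suc m d) eq))

  -- Since σ g = g, the difference σ h - h = (σ R - R) + g (σ Q - Q) splits by degree.
  σ-fixed-division : ∀ {h R Q} → DegreeBelow p R → h ≋ (R +ₚ (g *ₚ Q)) → σ h ≋ h →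
                     σ R ≋ R × σ Q ≋ Q
  σ-fixed-division {h} {R} {Q} degR h≋ σh≋h = σR≋R , σQ≋Q
    where
    σR+gσQ≋R+gQ : (σ R +ₚ (g *ₚ σ Q)) ≋ (R +ₚ (g *ₚ Q))
    σR+gσQ≋R+gQ = ≋-trans (≋-sym σh≋) (≋-trans σh≋h h≋)
      where
      σh≋ : σ h ≋ (σ R +ₚ (g *ₚ σ Q))
      σh≋ = ≋-trans (σ-cong h≋)
        (≋-trans (σ-+ R (g *ₚ Q)) (+ₚ-congˡ (σ R) (≋-trans (σ-* g Q) (*ₚ-congˡ (σ Q) σ-g))))
    g*ΔQ≋R-σR : (g *ₚ (σ Q +ₚ (-ₚ Q))) ≋ (R +ₚ (-ₚ σ R))
    g*ΔQ≋R-σR = ≋-trans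
      (solveₚ 5 (λ sR R G sQ Q → G ⊛ (sQ ⊖ Q) ⊜ ((sR ⊕ G ⊛ sQ) ⊖ (R ⊕ G ⊛ Q)) ⊕ (R ⊖ sR))
                ≋-refl (σ R) R g (σ Q) Q)
      (+ₚ-congʳ (R +ₚ (-ₚ σ R)) (≋-trans (+ₚ-congʳ (-ₚ (R +ₚ (g *ₚ Q))) σR+gσQ≋R+gQ)
                                         (+ₚ-inverseʳ (R +ₚ (g *ₚ Q)))))
    σQ≋Q : σ Q ≋ Q
    σQ≋Q = ≋-trans (solveₚ 2 (λ sQ Q → sQ ⊜ (sQ ⊖ Q) ⊕ Q) ≋-refl (σ Q) Q) (+ₚ-congʳ Q ΔQ≋[])
      where
      ΔQ≋[] : (σ Q +ₚ (-ₚ Q)) ≋ []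
      ΔQ≋[] = DegreeBelow-0 _ (g*ₚ-DegreeBelow⁻¹ 0 _ (DegreeBelow-cong (≋-sym g*ΔQ≋R-σR)
                (DegreeBelow-− R (σ R) degR (σ-DegreeBelow p R degR))))
    σR≋R : σ R ≋ R
    σR≋R = ≋-trans (solveₚ 3 (λ sR G sQ → sR ⊜ (sR ⊕ G ⊛ sQ) ⊖ G ⊛ sQ) ≋-refl (σ R) g (σ Q))
      (≋-trans (+ₚ-cong σR+gσQ≋R+gQ (-ₚ-cong (*ₚ-congʳ g σQ≋Q)))
               (solveₚ 2 (λ R G → (R ⊕ G) ⊖ G ⊜ R) ≋-refl R (g *ₚ Q)))

  polyInG : ∀ {m} → Vec Carrier m → Poly
  polyInG []       = []
  polyInG (a ∷ as) = constP a +ₚ (g *ₚ polyInG as)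

  σ-fixed⇒polyInG : ∀ m h → DegreeBelow (p ℕ.* m) h → σ h ≋ h → Σ (Vec Carrier m) λ as → h ≋ polyInG as
  σ-fixed⇒polyInG zero    h deg _ = [] , DegreeBelow-0 h (≡.subst (λ d → DegreeBelow d h) (ℕP.*-zeroʳ p) deg)
  σ-fixed⇒polyInG (suc m) h deg σh≋h =
    coeff R 0 ∷ proj₁ expansion , ≋-trans h≋ (+ₚ-cong (σ-fixed∧DegreeBelow-p⇒constant R degR (proj₁ fixed))
                                                     (*ₚ-congʳ g (proj₂ expansion)))
    where
    open DivisionByG (divide-by-g h)
      renaming (remainder to R; quotient to Q; remainder-degree to degR; h≋remainder+g*quotient to h≋)
    fixed = σ-fixed-division degR h≋ σh≋h
    degQ : DegreeBelow (p ℕ.* m) Q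
    degQ = g*ₚ-DegreeBelow⁻¹ (p ℕ.* m) Q (DegreeBelow-cong g*Q≋h-R
      (DegreeBelow-− h R (DegreeBelow-mono h (ℕP.≤-reflexive p[1+m]≡pm+p) deg)
                         (DegreeBelow-mono R (ℕP.m≤n+m p (p ℕ.* m)) degR)))
      where
      p[1+m]≡pm+p : p ℕ.* suc m ≡ p ℕ.* m ℕ.+ p
      p[1+m]≡pm+p = ≡.trans (ℕP.*-suc p m) (ℕP.+-comm p (p ℕ.* m))
      g*Q≋h-R : (h +ₚ (-ₚ R)) ≋ (g *ₚ Q)
      g*Q≋h-R = ≋-trans (+ₚ-congʳ (-ₚ R) h≋) (solveₚ 2 (λ R G → (R ⊕ G) ⊖ R ⊜ G) ≋-refl R (g *ₚ Q))
    expansion = σ-fixed⇒polyInG m Q degQ (proj₂ fixed)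

  A≋σ-σ₀ : ∀ f → A r f ≋ (σ f +ₚ (-ₚ constP (coeff (σ f) 0)))
  A≋σ-σ₀ f = +ₚ-congˡ (σ f) (-ₚ-cong (constP-cong (eval≈coeff-σ f)))

  coeff-g-zero : coeff g 0 ≈ 0#
  coeff-g-zero = trans (at g≋ 0) (trans (coeff-+ (X ^ₚ p) (constP (- b) *ₚ X) 0)
    (trans (+-cong (coeff-X^-≢ p 0 (λ ())) (trans (coeff-*-zero (constP (- b)) X) (zeroʳ _))) (+-identityʳ 0#)))

  coeff-g^-zero : ∀ j → 1 ≤ j → coeff (g ^ₚ j) 0 ≈ 0#
  coeff-g^-zero (suc j) _ = trans (coeff-*-zero g (g ^ₚ j)) (trans (*-congʳ coeff-g-zero) (zeroˡ _))

  g^p^k≋ : ∀ k →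
    (g ^ₚ (p ^ k)) ≋ ((X ^ₚ (p ^ suc k)) +ₚ (constP ((- b) ^F (p ^ k)) *ₚ (X ^ₚ (p ^ k))))
  g^p^k≋ k = ≋-trans (^ₚ-cong g≋ (p ^ k)) (≋-trans (frobeniusₚ k (X ^ₚ p) (constP (- b) *ₚ X))
    (+ₚ-cong (^ₚ-assoc X p (p ^ k))
             (≋-trans (*ₚ-^ₚ (constP (- b)) X (p ^ k)) (*ₚ-congˡ (X ^ₚ (p ^ k)) (constP-^ (- b) (p ^ k))))))

  DegreeBelow-g^ : ∀ j → DegreeBelow (suc (p ℕ.* j)) (g ^ₚ j)
  DegreeBelow-g^ zero    (suc i) _ = refl
  DegreeBelow-g^ (suc j) = ≡.subst (λ d → DegreeBelow (suc d) (g ^ₚ suc j)) (≡.sym (ℕP.*-suc p j))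
    (DegreeBelow-* p (p ℕ.* j) g (g ^ₚ j) DegreeBelow-g (DegreeBelow-g^ j))
    where
    DegreeBelow-g : DegreeBelow (suc p) g
    DegreeBelow-g i 1+p≤i = trans (at g≋ i) (trans (coeff-+ (X ^ₚ p) (constP (- b) *ₚ X) i)
      (trans (+-cong (coeff-X^-≢ p i (λ i≡p → ℕP.<-irrefl (≡.sym i≡p) 1+p≤i))
                     (trans (at (≋-sym (·ₚ-as-*ₚ (- b) X)) i) (trans (coeff-· (- b) X i)
                       (*-congˡ (coeff-X-≥2 i (ℕP.≤-trans (s≤s (s≤s z≤n)) 1+p≤i))))))
             (trans (+-identityˡ _) (zeroʳ _))))

  module _ (n′ q : ℕ) (q≡p^n : q ≡ p ^ suc n′) (3≤q : 3 ≤ q) where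

    m : ℕ
    m = p ^ n′

    Generator : Poly → Set c
    Generator = Gen p (suc n′) b

    open Span Generator

    1≤m : 1 ≤ m
    1≤m = ℕP.m^n>0 p n′

    2+m≤q : 2 ℕ.+ m ≤ q
    2+m≤q = ≡.subst (2 ℕ.+ m ≤_) (≡.sym q≡p^n) (bound m 1≤m (≡.subst (3 ≤_) q≡p^n 3≤q))
      where
      bound : ∀ x → 1 ≤ x → 3 ≤ p ℕ.* x → 2 ℕ.+ x ≤ p ℕ.* x
      bound (suc zero)     _ 3≤p·1 = 3≤p·1
      bound x@(suc (suc _)) _ _   = ℕP.≤-trans (ℕP.+-monoˡ-≤ x (ℕP.m≤m+n 2 _))
        (ℕP.≤-trans (ℕP.≤-reflexive (≡.cong (x ℕ.+_) (≡.sym (ℕP.+-identityʳ x))))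
                    (ℕP.*-monoˡ-≤ x (s≤s 1≤p′)))

    p≤q : p ≤ q
    p≤q = ≡.subst (p ≤_) (≡.sym q≡p^n)
      (ℕP.≤-trans (ℕP.≤-reflexive (≡.sym (ℕP.*-identityʳ p))) (ℕP.*-monoʳ-≤ p 1≤m))

    power-of-p? : ∀ j → Dec (∃ λ k → p ^ k ≡ j)
    power-of-p? j with Fin.any? {suc j} (λ k → p ^ Fin.toℕ k ℕ.≟ j)
    ... | yes (k , p^k≡j) = yes (Fin.toℕ k , p^k≡j)
    ... | no  ∄k          = no λ { (k , p^k≡j) →
      let k<1+j = s≤s (ℕP.≤-trans (ℕP.<⇒≤ (n<m^n (s≤s 1≤p′) k)) (ℕP.≤-reflexive p^k≡j))
      in ∄k (Fin.fromℕ< k<1+j , ≡.trans (≡.cong (p ^_) (Fin.toℕ-fromℕ< k<1+j)) p^k≡j) }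

    ·g^p^k-InSpan : ∀ a k → p ^ k ℕ.< m → InSpan Generator (a ·ₚ (g ^ₚ (p ^ k)))
    ·g^p^k-InSpan a k p^k<m =
      InSpan-cong (≋-sym a·g^p^k≋) (InSpan-+ (a ·ₚ (X ^ₚ (p ^ suc k))) ((a * β) ·ₚ (X ^ₚ (p ^ k)))
        (InSpan-generator a _ (inj₁ (suc k , s≤s k<n′ , ≡.refl)))
        (InSpan-generator (a * β) _ (inj₁ (k , ℕP.m<n⇒m<1+n k<n′ , ≡.refl))))
      where
      β = (- b) ^F (p ^ k)
      k<n′ : k ℕ.< n′
      k<n′ = ℕP.≰⇒> λ n′≤k → ℕP.<-irrefl ≡.refl (ℕP.<-≤-trans p^k<m (ℕP.^-monoʳ-≤ p n′≤k))
      a·g^p^k≋ : (a ·ₚ (g ^ₚ (p ^ k))) ≋ ((a ·ₚ (X ^ₚ (p ^ suc k))) +ₚ ((a * β) ·ₚ (X ^ₚ (p ^ k))))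
      a·g^p^k≋ = ≋-trans (·ₚ-cong refl (g^p^k≋ k)) (≋-trans (·ₚ-as-*ₚ a (P₁ +ₚ (constP β *ₚ P₂)))
        (≋-trans (solveₚ 4 (λ A P₁ B P₂ → A ⊛ (P₁ ⊕ B ⊛ P₂) ⊜ A ⊛ P₁ ⊕ (A ⊛ B) ⊛ P₂)
                           ≋-refl (constP a) P₁ (constP β) P₂)
                 (≋-sym (+ₚ-cong (·ₚ-as-*ₚ a P₁)
                                 (≋-trans (·ₚ-as-*ₚ (a * β) P₂) (*ₚ-congˡ P₂ (constP-* a β)))))))
        where
        P₁ = X ^ₚ (p ^ suc k)
        P₂ = X ^ₚ (p ^ k)

    ·g^-InSpan : ∀ a j → 1 ≤ j → j ℕ.< m → InSpan Generator (a ·ₚ (g ^ₚ j))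
    ·g^-InSpan a j 1≤j j<m with power-of-p? j
    ... | yes (k , p^k≡j) = ≡.subst (λ j → InSpan Generator (a ·ₚ (g ^ₚ j))) p^k≡j
                                    (·g^p^k-InSpan a k (≡.subst (ℕ._< m) (≡.sym p^k≡j) j<m))
    ... | no ¬power = non-power j 1≤j j<m ¬power
      where
      non-power : ∀ j → 1 ≤ j → j ℕ.< m → ¬ (∃ λ k → p ^ k ≡ j) → InSpan Generator (a ·ₚ (g ^ₚ j))
      non-power (suc zero)    _ _   ¬power = ⊥-elim (¬power (0 , ≡.refl))
      non-power (suc (suc j)) _ j<m ¬power =
        InSpan-generator a _ (inj₂ (suc (suc j) , s≤s (s≤s z≤n) , ℕP.∸-monoˡ-≤ 1 j<m , ¬power , ≡.refl))

    g^*polyInG-InSpan : ∀ {k} j (as : Vec Carrier k) → 1 ≤ j → j ℕ.+ k ≤ m →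
                        InSpan Generator ((g ^ₚ j) *ₚ polyInG as)
    g^*polyInG-InSpan j [] _ _ = InSpan-cong (≋-sym (*ₚ-zeroʳ (g ^ₚ j))) InSpan-[]
    g^*polyInG-InSpan {suc k} j (a ∷ as) 1≤j j+1+k≤m =
      InSpan-cong (≋-sym split) (InSpan-+ (a ·ₚ (g ^ₚ j)) ((g ^ₚ suc j) *ₚ polyInG as)
        (·g^-InSpan a j 1≤j (ℕP.<-≤-trans (ℕP.m<m+n j (s≤s z≤n)) j+1+k≤m))
        (g^*polyInG-InSpan (suc j) as (s≤s z≤n) 1+j+k≤m))
      where
      1+j+k≤m : suc j ℕ.+ k ≤ m
      1+j+k≤m = ℕP.≤-trans (ℕP.≤-reflexive (≡.sym (ℕP.+-suc j k))) j+1+k≤m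
      split : ((g ^ₚ j) *ₚ polyInG (a ∷ as)) ≋ ((a ·ₚ (g ^ₚ j)) +ₚ ((g ^ₚ suc j) *ₚ polyInG as))
      split = ≋-trans (solveₚ 4 (λ Gʲ A G P → Gʲ ⊛ (A ⊕ G ⊛ P) ⊜ A ⊛ Gʲ ⊕ (G ⊛ Gʲ) ⊛ P)
                                ≋-refl (g ^ₚ j) (constP a) g (polyInG as))
                      (+ₚ-congʳ _ (≋-sym (·ₚ-as-*ₚ a (g ^ₚ j))))

    polyInG-InSpan : ∀ {k} (as : Vec Carrier k) → k ≤ m → coeff (polyInG as) 0 ≈ 0# →
                     InSpan Generator (polyInG as)
    polyInG-InSpan []       _   _    = InSpan-[]
    polyInG-InSpan (a ∷ as) k≤m c₀≈0 = InSpan-cong (≋-sym polyInG≋) (g^*polyInG-InSpan 1 as ℕP.≤-refl k≤m)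
      where
      a≈0 : a ≈ 0#
      a≈0 = trans (sym (trans (coeff-+ (constP a) (g *ₚ polyInG as) 0)
                  (trans (+-congˡ (trans (coeff-*-zero g (polyInG as)) (trans (*-congʳ coeff-g-zero) (zeroˡ _))))
                         (+-identityʳ a))))
                  c₀≈0
      polyInG≋ : polyInG (a ∷ as) ≋ ((g ^ₚ 1) *ₚ polyInG as)
      polyInG≋ = ≋-trans (+ₚ-congʳ (g *ₚ polyInG as) (≋-trans (constP-cong a≈0) constP-0#))
                         (*ₚ-congˡ (polyInG as) (≋-sym (*ₚ-identityʳ g)))

    -- f - (f(r) / r) x is fixed by σ, hence a polynomial in g without constant term.
    eigenvector⇒InSpan : ∀ f → InV q f → A r f ≋ f → InSpan Generator f
    eigenvector⇒InSpan f (deg-f , f₀≈0) Af≋f =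
      InSpan-cong (≋-sym f≋h+aX) (InSpan-+ h (a ·ₚ X)
        (InSpan-cong (≋-sym (proj₂ expansion)) (polyInG-InSpan (proj₁ expansion) ℕP.≤-refl c₀≈0))
        aX-InSpan)
      where
      e = eval f r
      r⁻¹ = proj₁ (inverse r r≉0)
      a = e * r⁻¹
      a*r≈e : a * r ≈ e
      a*r≈e = trans (solve 3 (λ e i r → (e :* i) :* r := e :* (r :* i)) refl e r⁻¹ r)
                    (trans (*-congˡ (proj₂ (inverse r r≉0))) (*-identityʳ e))
      h = f +ₚ (-ₚ (a ·ₚ X))
      f≋h+aX : f ≋ (h +ₚ (a ·ₚ X))
      f≋h+aX = solveₚ 2 (λ F Y → F ⊜ (F ⊖ Y) ⊕ Y) ≋-refl f (a ·ₚ X)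
      σf≋ : σ f ≋ (f +ₚ constP e)
      σf≋ = ≋-trans (solveₚ 2 (λ S E → S ⊜ (S ⊖ E) ⊕ E) ≋-refl (σ f) (constP e))
                    (+ₚ-congʳ (constP e) Af≋f)
      σh≋h : σ h ≋ h
      σh≋h = ≋-trans (σ-+ f (-ₚ (a ·ₚ X)))
        (≋-trans (+ₚ-cong (≋-trans σf≋ (+ₚ-congˡ f (≋-trans (constP-cong (sym a*r≈e)) (constP-* a r))))
                          (≋-trans (σ-neg (a ·ₚ X)) (-ₚ-cong (≋-trans (σ-· a X)
                                   (≋-trans (·ₚ-as-*ₚ a (σ X)) (*ₚ-congʳ (constP a) σ-X))))))
        (≋-trans (solveₚ 4 (λ F A R x → (F ⊕ A ⊛ R) ⊕ (⊝ (A ⊛ (x ⊕ R))) ⊜ F ⊕ (⊝ (A ⊛ x)))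
                           ≋-refl f (constP a) (constP r) X)
                 (+ₚ-congˡ f (-ₚ-cong (≋-sym (·ₚ-as-*ₚ a X))))))
      deg-h : DegreeBelow (p ℕ.* m) h
      deg-h = DegreeBelow-− f (a ·ₚ X)
        (DegreeBelow-mono f (ℕP.≤-trans (ℕP.m∸n≤m q 1) (ℕP.≤-reflexive q≡p^n)) deg-f)
        (DegreeBelow-mono (a ·ₚ X) (ℕP.≤-trans (s≤s 1≤p′) (ℕP.≤-trans p≤q (ℕP.≤-reflexive q≡p^n)))
          λ i 2≤i → trans (coeff-· a X i) (trans (*-congˡ (coeff-X-≥2 i 2≤i)) (zeroʳ a)))
      expansion = σ-fixed⇒polyInG m h deg-h σh≋h
      c₀≈0 : coeff (polyInG (proj₁ expansion)) 0 ≈ 0#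
      c₀≈0 = trans (sym (at (proj₂ expansion) 0)) (trans (coeff-+ f (-ₚ (a ·ₚ X)) 0)
        (trans (+-cong f₀≈0 (-‿cong (zeroʳ a))) (trans (+-identityˡ _) -0#≈0#)))
      aX-InSpan : InSpan Generator (a ·ₚ X)
      aX-InSpan = InSpan-cong (·ₚ-cong refl (*ₚ-identityʳ X)) (InSpan-generator a _ (inj₁ (0 , s≤s z≤n , ≡.refl)))

    A-cong : ∀ {f h} → f ≋ h → A r f ≋ A r h
    A-cong {f} {h} f≋h = ≋-trans (A≋σ-σ₀ f)
      (≋-trans (+ₚ-cong (σ-cong f≋h) (-ₚ-cong (constP-cong (at (σ-cong f≋h) 0)))) (≋-sym (A≋σ-σ₀ h)))

    A-+ : ∀ f h → A r (f +ₚ h) ≋ (A r f +ₚ A r h)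
    A-+ f h = ≋-trans (A≋σ-σ₀ (f +ₚ h)) (≋-trans
      (+ₚ-cong (σ-+ f h) (-ₚ-cong (constP-cong (trans (at (σ-+ f h) 0) (coeff-+ (σ f) (σ h) 0)))))
      (≋-trans (solveₚ 4 (λ S T C D → (S ⊕ T) ⊖ (C ⊕ D) ⊜ (S ⊖ C) ⊕ (T ⊖ D))
                         ≋-refl (σ f) (σ h) (constP (coeff (σ f) 0)) (constP (coeff (σ h) 0)))
               (≋-sym (+ₚ-cong (A≋σ-σ₀ f) (A≋σ-σ₀ h)))))

    A-· : ∀ k f → A r (k ·ₚ f) ≋ (k ·ₚ A r f)
    A-· k f = ≋-trans (A≋σ-σ₀ (k ·ₚ f)) (≋-trans
      (+ₚ-cong (≋-trans (σ-· k f) (·ₚ-as-*ₚ k (σ f)))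
               (-ₚ-cong (≋-trans (constP-cong (trans (at (σ-· k f) 0) (coeff-· k (σ f) 0)))
                                 (constP-* k (coeff (σ f) 0)))))
      (≋-trans (solveₚ 3 (λ K S C → K ⊛ S ⊖ K ⊛ C ⊜ K ⊛ (S ⊖ C))
                         ≋-refl (constP k) (σ f) (constP (coeff (σ f) 0)))
               (≋-trans (*ₚ-congʳ (constP k) (≋-sym (A≋σ-σ₀ f))) (≋-sym (·ₚ-as-*ₚ k (A r f))))))

    Eigenvector : Poly → Set ℓ
    Eigenvector f = InV q f × (A r f ≋ f)

    Eigenvector-cong : ∀ {f h} → f ≋ h → Eigenvector f → Eigenvector h
    Eigenvector-cong f≋h ((deg , f₀≈0) , Af≋f) =
      ((λ i q∸1≤i → trans (sym (at f≋h i)) (deg i q∸1≤i)) , trans (sym (at f≋h 0)) f₀≈0) ,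
      ≋-trans (A-cong (≋-sym f≋h)) (≋-trans Af≋f f≋h)

    Eigenvector-[] : Eigenvector []
    Eigenvector-[] = ((λ _ _ → refl) , refl) , coeffwise λ { zero → -0#≈0# ; (suc i) → refl }

    Eigenvector-+ : ∀ {f h} → Eigenvector f → Eigenvector h → Eigenvector (f +ₚ h)
    Eigenvector-+ {f} {h} ((deg-f , f₀≈0) , Af≋f) ((deg-h , h₀≈0) , Ah≋h) =
      ((λ i q∸1≤i → trans (coeff-+ f h i) (trans (+-cong (deg-f i q∸1≤i) (deg-h i q∸1≤i)) (+-identityʳ 0#))) ,
       trans (coeff-+ f h 0) (trans (+-cong f₀≈0 h₀≈0) (+-identityʳ 0#))) ,
      ≋-trans (A-+ f h) (+ₚ-cong Af≋f Ah≋h)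

    Eigenvector-· : ∀ k {f} → Eigenvector f → Eigenvector (k ·ₚ f)
    Eigenvector-· k {f} ((deg , f₀≈0) , Af≋f) =
      ((λ i q∸1≤i → trans (coeff-· k f i) (trans (*-congˡ (deg i q∸1≤i)) (zeroʳ k))) ,
       trans (coeff-· k f 0) (trans (*-congˡ f₀≈0) (zeroʳ k))) ,
      ≋-trans (A-· k f) (·ₚ-cong refl Af≋f)

    σ-fixed⇒Eigenvector : ∀ f → InV q f → σ f ≋ f → Eigenvector f
    σ-fixed⇒Eigenvector f inV@(_ , f₀≈0) σf≋f = inV , ≋-trans (A≋σ-σ₀ f)
      (≋-trans (+ₚ-cong σf≋f (-ₚ-cong (≋-trans (constP-cong (trans (at σf≋f 0) f₀≈0)) constP-0#)))
               (+ₚ-identityʳ f))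

    Eigenvector-X^p^ : ∀ k → k ℕ.< suc n′ → Eigenvector (X ^ₚ (p ^ k))
    Eigenvector-X^p^ k (s≤s k≤n′) = inV , ≋-trans (A≋σ-σ₀ xᴺ) (≋-trans
      (+ₚ-congˡ (σ xᴺ) (-ₚ-cong (constP-cong (trans (at (σ-X^p^ k) 0)
        (trans (coeff-+ xᴺ (constP (r ^F N)) 0) (trans (+-congʳ (proj₂ inV)) (+-identityˡ _)))))))
      (≋-trans (+ₚ-congʳ (-ₚ constP (r ^F N)) (σ-X^p^ k))
               (solveₚ 2 (λ Y C → (Y ⊕ C) ⊖ C ⊜ Y) ≋-refl xᴺ (constP (r ^F N)))))
      where
      N = p ^ k
      xᴺ = X ^ₚ N
      N<q∸1 : N ℕ.< q ∸ 1
      N<q∸1 = ℕP.≤-trans (s≤s (ℕP.^-monoʳ-≤ p k≤n′)) (ℕP.∸-monoˡ-≤ 1 2+m≤q)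
      inV : InV q xᴺ
      inV = (λ i q∸1≤i → coeff-X^-≢ N i λ i≡N → ℕP.<-irrefl (≡.sym i≡N) (ℕP.<-≤-trans N<q∸1 q∸1≤i))
          , coeff-X^-≢ N 0 (ℕP.<⇒≢ (ℕP.m^n>0 p k))

    Eigenvector-g^ : ∀ j → 1 ≤ j → j ≤ m ∸ 1 → Eigenvector (g ^ₚ j)
    Eigenvector-g^ j 1≤j j≤m∸1 = σ-fixed⇒Eigenvector (g ^ₚ j)
      ((λ i q∸1≤i → DegreeBelow-g^ j i (ℕP.≤-trans 1+pj≤q∸1 q∸1≤i)) , coeff-g^-zero j 1≤j)
      (≋-trans (σ-^ g j) (^ₚ-cong σ-g j))
      where
      1+pj≤q∸1 : suc (p ℕ.* j) ≤ q ∸ 1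
      1+pj≤q∸1 = ℕP.≤-trans (s≤s (ℕP.≤-trans (ℕP.*-monoʳ-≤ p j≤m∸1)
                   (ℕP.≤-reflexive (≡.trans (ℕP.*-distribˡ-∸ p m 1)
                     (≡.cong₂ _∸_ (≡.sym q≡p^n) (ℕP.*-identityʳ p))))))
                   (ℕP.∸-monoʳ-< (s≤s 1≤p′) p≤q)

    Eigenvector-generator : ∀ k h → Generator h → Eigenvector (k ·ₚ h)
    Eigenvector-generator k h (inj₁ (j , j<n , ≡.refl))                 = Eigenvector-· k (Eigenvector-X^p^ j j<n)
    Eigenvector-generator k h (inj₂ (j , 2≤j , j≤m∸1 , _ , ≡.refl)) =
      Eigenvector-· k (Eigenvector-g^ j (ℕP.≤-trans (s≤s z≤n) 2≤j) j≤m∸1)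

    eigenvector⇔InSpan : ∀ f → (InV q f × (A r f ≈ₚ f)) ⇔ InSpan Generator f
    eigenvector⇔InSpan f = mk⇔
      (λ (inV , Af≈f) → eigenvector⇒InSpan f inV (coeffwise Af≈f))
      (λ f∈span → let (inV , Af≋f) = InSpan-elim Eigenvector Eigenvector-cong Eigenvector-[] Eigenvector-+
                                                 (λ k {h} → Eigenvector-generator k h) {f} f∈span
                  in inV , at Af≋f)

theorem2 : ∀ {c ℓ : Level} (p n q : ℕ) → Prime p → q ≡ p ^ n → 3 ≤ q →
  (F : Field c ℓ) → Inverse (Field.setoid F) (setoid (Fin q)) →
  let open Field F
      open PolyOps F
  in (r : Carrier) → ¬ (r ≈ 0#) →
     ∀ f → (InV q f × (A r f ≈ₚ f)) ⇔ InSpan (Gen p n (r ^F (p ∸ 1))) f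
theorem2 zero     _        _ p-prime _      _ =
  ⊥-elim (ℕP.<⇒≱ (nonTrivial⇒n>1 0 {{prime⇒nonTrivial p-prime}}) z≤n)
theorem2 (suc p′) zero     _ _       ≡.refl (s≤s ())
theorem2 (suc p′) (suc n′) q p-prime q≡p^n 3≤q F enum r r≉0 =
  Eigenspace.eigenvector⇔InSpan F p-prime (FiniteField.ι-base≈0 F enum {suc p′} {suc n′} q≡p^n)
                                r r≉0 n′ q q≡p^n 3≤q
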